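{- For all $n\ge1$ and $0\le k\le n-1$, \[ d_{n,k}=d_{n-1,k-1}+d_{n-1,k}+2\sum_{i=2}^{n-1}\binom{n-2}{i-1}\sum_{j=0}^{i-2}\binom{i-2}{j}\,d_{n-i,k-j-1}, \] where $d_{n,k}$ is the number of $\sigma\in\mathcal{R}_n^B$ with $\mathrm{des}(\sigma)=k$.
   Context: $[n]=\{1,\dots,n\}$, $\langle n\rangle=\{0,\pm1,\dots,\pm n\}$. A type $B$ set partition of $\langle n\rangle$ without zero block is encoded as $\pi=\pi_1\mid\cdots\mid\pi_k$: nonempty sets of nonzero integers with the sets $\{|a|:a\in\pi_i\}$ partitioning $[n]$, the element of smallest absolute value $m_i$ of $\pi_i$ positive, $m_1<\cdots<m_k$. It is merging-free if there is no $i\ge2$ with $\max_{a\in\pi_{i-1}}|a|<m_i$. $\mathrm{Flatten}(\pi)$ concatenates $\pi_1,\pi_2,\dots$, each written in increasing order of absolute value; $\mathcal{R}_n^B$ is the set of $\mathrm{Flatten}(\pi)$ over merging-free $\pi$. For $\sigma=\sigma_1\cdots\sigma_n$, $i\in[n-1]$ is a descent if $\sigma_i>\sigma_{i+1}$ (usual integer order); $\mathrm{des}(\sigma)$ is the number of descents. Conventions: $d_{0,0}=1$ (the empty word), and $d_{m,j}=0$ whenever $j<0$ or $j>\max(m-1,0)$. -}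

module Defs where

open import Data.Bool using (Bool; true; false; _∧_; _∨_; not; if_then_else_)
open import Data.Nat using (ℕ; zero; suc; _+_; _*_; _∸_; _≡ᵇ_; _<ᵇ_)
open import Data.Integer using (ℤ; +_; -[1+_]; ∣_∣)
import Data.Integer as ℤ
open import Data.List using (List; []; _∷_; map; concatMap; length; filter; upTo; concat; _++_)
open import Data.Bool.ListAction using (any; all)
open import Data.Nat.ListAction using (sum)
open import Relation.Nullary.Decidable using (⌊_⌋)

des : List ℤ → ℕ
des [] = 0
des (x ∷ []) = 0
des (x ∷ y ∷ ys) = (if ⌊ y ℤ.<? x ⌋ then 1 else 0) + des (y ∷ ys)

-- A partition is a list of blocks π₁ ∣ ⋯ ∣ πₖ; each block (a finite set of
-- nonzero integers) is represented by the list of its elements written in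
-- increasing order of absolute value (strictly increasing absolute values).

absStrictIncr : List ℤ → Bool
absStrictIncr [] = true
absStrictIncr (x ∷ []) = true
absStrictIncr (x ∷ y ∷ ys) = (∣ x ∣ <ᵇ ∣ y ∣) ∧ absStrictIncr (y ∷ ys)

-- element of smallest absolute value is positive (it is the first one)
minPositive : List ℤ → Bool
minPositive [] = false
minPositive (+ zero ∷ _) = false
minPositive (+ suc _ ∷ _) = true
minPositive (-[1+ _ ] ∷ _) = false

validBlock : List ℤ → Bool
validBlock b = absStrictIncr b ∧ minPositive b

minAbs : List ℤ → ℕ
minAbs [] = 0
minAbs (x ∷ _) = ∣ x ∣

maxAbs : List ℤ → ℕ
maxAbs [] = 0
maxAbs (x ∷ []) = ∣ x ∣
maxAbs (x ∷ y ∷ ys) = maxAbs (y ∷ ys)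

minsIncr : List (List ℤ) → Bool
minsIncr [] = true
minsIncr (b ∷ []) = true
minsIncr (b ∷ c ∷ cs) = (minAbs b <ᵇ minAbs c) ∧ minsIncr (c ∷ cs)

elemℕ : ℕ → List ℕ → Bool
elemℕ a xs = any (λ x → a ≡ᵇ x) xs

-- the sets {|a| : a ∈ πᵢ} partition [n]: the absolute values of all
-- elements are n in number and cover every element of [n] = {1,…,n}
absPartition : ℕ → List (List ℤ) → Bool
absPartition n π =
  let as = map ∣_∣ (concat π) in
  (length as ≡ᵇ n) ∧ all (λ i → elemℕ (suc i) as) (upTo n)

isTypeBPartition : ℕ → List (List ℤ) → Bool
isTypeBPartition n π = all validBlock π ∧ minsIncr π ∧ absPartition n π

mergingFree : List (List ℤ) → Bool
mergingFree [] = true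
mergingFree (b ∷ []) = true
mergingFree (b ∷ c ∷ cs) = not (maxAbs b <ᵇ minAbs c) ∧ mergingFree (c ∷ cs)

Flatten : List (List ℤ) → List ℤ
Flatten = concat

-- Membership in R_n^B.
-- If Flatten π ≡ σ then π is a splitting of σ into consecutive nonempty
-- segments, so σ ∈ R_n^B iff some such splitting is a merging-free type B
-- partition of ⟨n⟩.

splits : List ℤ → List (List (List ℤ))
splits [] = [] ∷ []
splits (x ∷ xs) = concatMap ext (splits xs)
  where
  ext : List (List ℤ) → List (List (List ℤ))
  ext [] = ((x ∷ []) ∷ []) ∷ []
  ext (b ∷ bs) = ((x ∷ []) ∷ b ∷ bs) ∷ ((x ∷ b) ∷ bs) ∷ []

inR : ℕ → List ℤ → Bool
inR n σ = any (λ π → isTypeBPartition n π ∧ mergingFree π) (splits σ)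

-- all words of length m over an alphabet (no duplicates if the alphabet
-- has none)
wordsOver : List ℤ → ℕ → List (List ℤ)
wordsOver A zero = [] ∷ []
wordsOver A (suc m) = concatMap (λ a → map (a ∷_) (wordsOver A m)) A

signedAlphabet : ℕ → List ℤ
signedAlphabet n = map (λ i → + suc i) (upTo n) ++ map -[1+_] (upTo n)

-- every element of R_n^B is a word of length n over {±1,…,±n}
candidates : ℕ → List (List ℤ)
candidates n = wordsOver (signedAlphabet n) n

d : ℕ → ℕ → ℕ
d n k = length (filter (λ σ → (inR n σ ∧ (des σ ≡ᵇ k)) Data.Bool.≟ true) (candidates n))

-- d_{m, k - s}, which is 0 when k - s < 0
dSub : ℕ → ℕ → ℕ → ℕ
dSub m k s = if s Data.Nat.≤ᵇ k then d m (k ∸ s) else 0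

sumFromTo : ℕ → ℕ → (ℕ → ℕ) → ℕ
sumFromTo a b f = sum (map (λ t → f (a + t)) (upTo (suc b ∸ a)))

{-# OPTIONS --safe #-}
module Submission where

-- A word lies in R_n^B exactly when it is a signed permutation of [n] whose maximal runs of
-- increasing absolute value (the blocks of its only merging-free splitting) begin with positive
-- letters at increasing heads, i.e. each run begins with the least value not used before it.
-- Reading a word left to right, admissibility of the rest depends only on the sign of the last
-- letter and on how many unused values lie below and above its absolute value, which yields a
-- recurrence for the descent polynomials. Summing over the possible ranks of the letter that
-- continues a run, Pascal's rule gives
--   D_{m+2} = (1 + t) D_{m+1} + 2 Σ_{i<m} C(m, i+1) t (1 + t)^i D_{m-i},
-- and comparing coefficients of t^k gives the statement.

open import Defs
open import Data.Bool using (Bool; true; false; if_then_else_; _∧_; _∨_; not)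
import Data.Bool as Bool
open import Data.Bool.Properties using (T-≡; ∧-conicalˡ; ∧-conicalʳ; ∧-zeroʳ; ∧-identityʳ; ∨-zeroʳ; not-injective)
open import Data.Bool.Solver using (module ∨-∧-Solver)
open import Data.Bool.ListAction using (any; all)
open import Data.Nat using (ℕ; zero; suc; pred; _+_; _*_; _∸_; _⊓_; _≤_; _<_; z≤n; s≤s; z<s; s<s; _<ᵇ_; _≡ᵇ_)
open import Data.Nat.Properties
import Algebra.Properties.CommutativeSemigroup as CommutativeSemigroupProperties
open import Data.Nat.Combinatorics using (_C_; k>n⇒nCk≡0; nCk+nC[k+1]≡[n+1]C[k+1])
open import Data.Nat.ListAction using (sum)
open import Data.Nat.Solver using (module +-*-Solver)
open import Data.Integer using (ℤ; +0; +[1+_]; -[1+_]; ∣_∣; +<+; -<+; -<-)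
import Data.Integer as ℤ
open import Data.List using (List; []; _∷_; map; concatMap; concat; length; filter; _++_; upTo; applyUpTo)
open import Data.List.Properties using (map-++; length-map; length-++; ++-assoc; ++-identityʳ; concatMap-++)
open import Data.List.Membership.Propositional using (_∈_; find; lose)
open import Data.List.Membership.Propositional.Properties
  using (∈-++⁺ˡ; ∈-++⁺ʳ; ∈-++⁻; ∈-∃++; ∈-map⁻; ∈-upTo⁻; ∈-concatMap⁺; ∈-concatMap⁻)
open import Data.List.Relation.Unary.Any using (here; there)
open import Data.Product using (∃; _×_; _,_; proj₁; proj₂)
open import Data.Sum using (_⊎_; inj₁; inj₂)
open import Data.Empty using (⊥; ⊥-elim)
open import Function using (_∘_; id)
open import Function.Bundles using (Equivalence)
open import Relation.Binary.PropositionalEquality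
open import Relation.Binary.Definitions using (tri<; tri≈; tri>)
open import Relation.Nullary using (¬_; contradiction)
open import Relation.Nullary.Decidable using (⌊_⌋; yes; no)

open CommutativeSemigroupProperties +-commutativeSemigroup using () renaming (interchange to +-interchange; xy∙z≈y∙xz to +-xy∙z≈y∙xz)
open CommutativeSemigroupProperties *-commutativeSemigroup using () renaming (x∙yz≈y∙xz to *-x∙yz≈y∙xz)

sumBelow : ℕ → (ℕ → ℕ) → ℕ
sumBelow zero    f = 0
sumBelow (suc n) f = f 0 + sumBelow n (f ∘ suc)

sumBelow-cong : ∀ n {f g : ℕ → ℕ} → (∀ i → i < n → f i ≡ g i) → sumBelow n f ≡ sumBelow n g
sumBelow-cong zero    eq = refl
sumBelow-cong (suc n) eq = cong₂ _+_ (eq 0 z<s) (sumBelow-cong n (λ i i<n → eq (suc i) (s<s i<n)))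

sumBelow-+ : ∀ n (f g : ℕ → ℕ) → sumBelow n (λ i → f i + g i) ≡ sumBelow n f + sumBelow n g
sumBelow-+ zero    f g = refl
sumBelow-+ (suc n) f g = begin
  (f 0 + g 0) + sumBelow n (λ i → f (suc i) + g (suc i))      ≡⟨ cong ((f 0 + g 0) +_) (sumBelow-+ n (f ∘ suc) (g ∘ suc)) ⟩
  (f 0 + g 0) + (sumBelow n (f ∘ suc) + sumBelow n (g ∘ suc)) ≡⟨ +-interchange (f 0) (g 0) _ _ ⟩
  (f 0 + sumBelow n (f ∘ suc)) + (g 0 + sumBelow n (g ∘ suc)) ∎
  where open ≡-Reasoning

sumBelow-* : ∀ n c (f : ℕ → ℕ) → sumBelow n (λ i → c * f i) ≡ c * sumBelow n f
sumBelow-* zero    c f = sym (*-zeroʳ c)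
sumBelow-* (suc n) c f = trans (cong (c * f 0 +_) (sumBelow-* n c (f ∘ suc))) (sym (*-distribˡ-+ c (f 0) _))

sumBelow-last : ∀ n (f : ℕ → ℕ) → sumBelow (suc n) f ≡ sumBelow n f + f n
sumBelow-last zero    f = +-comm (f 0) 0
sumBelow-last (suc n) f = trans (cong (f 0 +_) (sumBelow-last n (f ∘ suc))) (sym (+-assoc (f 0) _ _))

sumBelow-zero : ∀ n (f : ℕ → ℕ) → (∀ i → f i ≡ 0) → sumBelow n f ≡ 0
sumBelow-zero zero    f f≡0 = refl
sumBelow-zero (suc n) f f≡0 = cong₂ _+_ (f≡0 0) (sumBelow-zero n (f ∘ suc) (f≡0 ∘ suc))

sumBelow-1 : ∀ n → sumBelow n (λ _ → 1) ≡ n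
sumBelow-1 zero    = refl
sumBelow-1 (suc n) = cong suc (sumBelow-1 n)

sumBelow≡0⇒≡0 : ∀ n (f : ℕ → ℕ) → sumBelow n f ≡ 0 → ∀ j → j < n → f j ≡ 0
sumBelow≡0⇒≡0 (suc n) f sum≡0 zero    _         = m+n≡0⇒m≡0 (f 0) sum≡0
sumBelow≡0⇒≡0 (suc n) f sum≡0 (suc j) (s≤s j<n) = sumBelow≡0⇒≡0 n (f ∘ suc) (m+n≡0⇒n≡0 (f 0) sum≡0) j j<n

sum-map-applyUpTo : ∀ n (g f : ℕ → ℕ) → sum (map g (applyUpTo f n)) ≡ sumBelow n (g ∘ f)
sum-map-applyUpTo zero    g f = refl
sum-map-applyUpTo (suc n) g f = cong (g (f 0) +_) (sum-map-applyUpTo n g (f ∘ suc))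

sum-map-upTo : ∀ n (g : ℕ → ℕ) → sum (map g (upTo n)) ≡ sumBelow n g
sum-map-upTo n g = sum-map-applyUpTo n g id

∸≡suc∸suc : ∀ q t → t < q → q ∸ t ≡ suc (q ∸ suc t)
∸≡suc∸suc (suc q) zero    _         = refl
∸≡suc∸suc (suc q) (suc t) (s<s t<q) = ∸≡suc∸suc q t t<q

𝟙 : Bool → ℕ
𝟙 b = if b then 1 else 0

sumBelow-≡ᵇ : ∀ n i → i < n → sumBelow n (λ j → 𝟙 (j ≡ᵇ i)) ≡ 1
sumBelow-≡ᵇ (suc n) zero    _         = cong suc (sumBelow-zero n _ (λ _ → refl))
sumBelow-≡ᵇ (suc n) (suc i) (s≤s i<n) = sumBelow-≡ᵇ n i i<n

noneBefore : (ℕ → Bool) → ℕ → Bool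
noneBefore p zero    = true
noneBefore p (suc i) = not (p 0) ∧ noneBefore (p ∘ suc) i

noneBefore-elim : ∀ (p : ℕ → Bool) i → noneBefore p i ≡ true → ∀ j → j < i → p j ≡ false
noneBefore-elim p (suc i) none zero    _         = not-injective (∧-conicalˡ (not (p 0)) _ none)
noneBefore-elim p (suc i) none (suc j) (s≤s j<i) = noneBefore-elim (p ∘ suc) i (∧-conicalʳ (not (p 0)) _ none) j j<i

noneBefore-intro : ∀ (p : ℕ → Bool) i → (∀ j → j < i → p j ≡ false) → noneBefore p i ≡ true
noneBefore-intro p zero    _    = refl
noneBefore-intro p (suc i) none rewrite none 0 (s≤s z≤n) = noneBefore-intro (p ∘ suc) i (λ j j<i → none (suc j) (s≤s j<i))

sumBelow-first : ∀ n (p : ℕ → Bool) → sumBelow n (λ i → 𝟙 (p i ∧ noneBefore p i)) ≡ 1 ⊓ sumBelow n (𝟙 ∘ p)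
sumBelow-first zero    p = refl
sumBelow-first (suc n) p with p 0
... | true  = cong suc (sumBelow-zero n _ (λ i → cong 𝟙 (∧-zeroʳ (p (suc i)))))
... | false = sumBelow-first n (p ∘ suc)

-- A polynomial in t, given by its coefficient sequence; t will mark descents.
Poly : Set
Poly = ℕ → ℕ

infixl 6 _⊕_
infix  4 _≈_

_⊕_ : Poly → Poly → Poly
(f ⊕ g) k = f k + g k

_≈_ : Poly → Poly → Set
f ≈ g = ∀ k → f k ≡ g k

0ₚ : Poly
0ₚ _ = 0

1ₚ : Poly
1ₚ zero    = 1
1ₚ (suc _) = 0

shift : Poly → Poly
shift f zero    = 0
shift f (suc k) = f k

shiftIf : Bool → Poly → Poly
shiftIf true  f = shift f
shiftIf false f = f

shift^ : ℕ → Poly → Poly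
shift^ zero    f = f
shift^ (suc j) f = shift (shift^ j f)

[1+t]^ : ℕ → Poly → Poly
[1+t]^ zero    f = f
[1+t]^ (suc j) f = [1+t]^ j f ⊕ shift ([1+t]^ j f)

shift-cong : ∀ {f g} → f ≈ g → shift f ≈ shift g
shift-cong f≈g zero    = refl
shift-cong f≈g (suc k) = f≈g k

shift^-cong : ∀ s {f g} → f ≈ g → shift^ s f ≈ shift^ s g
shift^-cong zero    f≈g = f≈g
shift^-cong (suc s) f≈g = shift-cong (shift^-cong s f≈g)

shiftIf-cong : ∀ s {f g} → f ≈ g → shiftIf s f ≈ shiftIf s g
shiftIf-cong true  = shift-cong
shiftIf-cong false f≈g = f≈g

[1+t]^-cong : ∀ j {f g} → f ≈ g → [1+t]^ j f ≈ [1+t]^ j g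
[1+t]^-cong zero    f≈g = f≈g
[1+t]^-cong (suc j) f≈g k = cong₂ _+_ ([1+t]^-cong j f≈g k) (shift-cong ([1+t]^-cong j f≈g) k)

shift-sumBelow : ∀ n (g : ℕ → Poly) k → shift (λ k′ → sumBelow n (λ i → g i k′)) k ≡ sumBelow n (λ i → shift (g i) k)
shift-sumBelow n g zero    = sym (sumBelow-zero n _ (λ _ → refl))
shift-sumBelow n g (suc k) = refl

[1+t]^-expand : ∀ j f k → [1+t]^ j f k ≡ sumBelow (suc j) (λ i → (j C i) * shift^ i f k)
[1+t]^-expand zero    f k = sym (trans (+-identityʳ _) (*-identityˡ (f k)))
[1+t]^-expand (suc j) f k = begin
  [1+t]^ j f k + shift ([1+t]^ j f) k
    ≡⟨ cong₂ _+_ ([1+t]^-expand j f k) (trans (shift-cong ([1+t]^-expand j f) k) (shift-sumBelow (suc j) (λ i k′ → (j C i) * shift^ i f k′) k)) ⟩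
  sumBelow (suc j) (λ i → (j C i) * shift^ i f k) + sumBelow (suc j) (λ i → shift (λ k′ → (j C i) * shift^ i f k′) k)
    ≡⟨ cong (1 * f k + lower +_) (sumBelow-cong (suc j) (λ i _ → shift-scale i k)) ⟩
  (1 * f k + lower) + upper
    ≡⟨ +-assoc (1 * f k) lower upper ⟩
  1 * f k + (lower + upper)
    ≡⟨ cong (λ z → 1 * f k + (z + upper)) (sym lower-extend) ⟩
  1 * f k + (sumBelow (suc j) (λ i → (j C suc i) * shift^ (suc i) f k) + upper)
    ≡⟨ cong (1 * f k +_) (trans (+-comm _ upper) (sym (sumBelow-+ (suc j) (λ i → (j C i) * shift^ (suc i) f k) (λ i → (j C suc i) * shift^ (suc i) f k)))) ⟩
  1 * f k + sumBelow (suc j) (λ i → (j C i) * shift^ (suc i) f k + (j C suc i) * shift^ (suc i) f k)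
    ≡⟨ cong (1 * f k +_) (sumBelow-cong (suc j) (λ i _ → pascal i)) ⟩
  1 * f k + sumBelow (suc j) (λ i → (suc j C suc i) * shift^ (suc i) f k) ∎
  where
  open ≡-Reasoning
  lower upper : ℕ
  lower = sumBelow j (λ i → (j C suc i) * shift^ (suc i) f k)
  upper = sumBelow (suc j) (λ i → (j C i) * shift^ (suc i) f k)
  lower-extend : sumBelow (suc j) (λ i → (j C suc i) * shift^ (suc i) f k) ≡ lower
  lower-extend = begin
    sumBelow (suc j) (λ i → (j C suc i) * shift^ (suc i) f k) ≡⟨ sumBelow-last j _ ⟩
    lower + (j C suc j) * shift^ (suc j) f k                  ≡⟨ cong (λ c → lower + c * shift^ (suc j) f k) (k>n⇒nCk≡0 (n<1+n j)) ⟩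
    lower + 0                                                 ≡⟨ +-identityʳ lower ⟩
    lower                                                     ∎
  shift-scale : ∀ i k → shift (λ k′ → (j C i) * shift^ i f k′) k ≡ (j C i) * shift^ (suc i) f k
  shift-scale i zero    = sym (*-zeroʳ (j C i))
  shift-scale i (suc k) = refl
  pascal : ∀ i → (j C i) * shift^ (suc i) f k + (j C suc i) * shift^ (suc i) f k ≡ (suc j C suc i) * shift^ (suc i) f k
  pascal i = trans (sym (*-distribʳ-+ _ (j C i) (j C suc i))) (cong (_* shift^ (suc i) f k) (nCk+nC[k+1]≡[n+1]C[k+1] j i))

shift-[1+t]^-expand : ∀ j f k → shift ([1+t]^ j f) k ≡ sumBelow (suc j) (λ i → (j C i) * shift^ (suc i) f k)
shift-[1+t]^-expand j f zero    = sym (sumBelow-zero (suc j) _ (λ i → *-zeroʳ (j C i)))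
shift-[1+t]^-expand j f (suc k) = [1+t]^-expand j f k

sumSplits : ℕ → (ℕ → ℕ → Poly) → Poly
sumSplits zero    h = 0ₚ
sumSplits (suc q) h = h 0 q ⊕ sumSplits q (h ∘ suc)

sumSplits-cong : ∀ q {h h′ : ℕ → ℕ → Poly} → (∀ x y → h x y ≈ h′ x y) → sumSplits q h ≈ sumSplits q h′
sumSplits-cong zero    h≈h′ k = refl
sumSplits-cong (suc q) h≈h′ k = cong₂ _+_ (h≈h′ 0 q k) (sumSplits-cong q (h≈h′ ∘ suc) k)


-- Descent polynomials of completions

eitherSign : (ℕ → ℕ → Bool → Poly) → ℕ → ℕ → Poly
eitherSign G p q = G p q true ⊕ shift (G p q false)

newRun : (ℕ → ℕ → Bool → Poly) → ℕ → ℕ → Bool → Poly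
newRun G zero    q s = 0ₚ
newRun G (suc p) q s = shiftIf s (G 0 (p + q) true)

-- completions m p q s is the descent polynomial of the admissible ways to write m more letters
-- after a last letter of sign s (true: positive) when p unused values lie below its absolute value
-- and q above. The run continues with an unused value above, of either sign (a negative one is a
-- descent; sumSplits ranges over its rank among the q), or, if p > 0, a new run starts with the
-- least unused value, which must be positive.
completions : ℕ → ℕ → ℕ → Bool → Poly
completions zero    p q s = 1ₚ
completions (suc m) p q s = newRun (completions m) p q s ⊕ sumSplits q (λ x y → eitherSign (completions m) (x + p) y)

completionsAbove : ℕ → Poly
completionsAbove m = completions m 0 m true

-- Before the first letter all n values are unused and lie below the virtual letter −(n+1), see start.
descentPoly : ℕ → Poly
descentPoly n = completions n n 0 false

completions-sign : ∀ m q s s′ → completions m 0 q s ≈ completions m 0 q s′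
completions-sign zero    q s s′ k = refl
completions-sign (suc m) q s s′ k = refl

closedForm : ℕ → ℕ → Poly
closedForm q r k = sumBelow q (λ t → (q C suc t) * (2 * shift ([1+t]^ t (completionsAbove (r + (q ∸ suc t)))) k))

closedForm-0 : ∀ q r → closedForm q r 0 ≡ 0
closedForm-0 q r = sumBelow-zero q _ (λ t → *-zeroʳ (q C suc t))

closedForm-suc : ∀ q r → closedForm (suc q) r
  ≈ (shift (completionsAbove (r + q)) ⊕ closedForm q r) ⊕ shift (completionsAbove (r + q) ⊕ closedForm q r) ⊕ closedForm q (suc r)
closedForm-suc q r zero = begin
  closedForm (suc q) r 0                        ≡⟨ closedForm-0 (suc q) r ⟩
  0                                             ≡⟨ sym (cong₂ _+_ (cong (_+ 0) (closedForm-0 q r)) (closedForm-0 q (suc r))) ⟩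
  (0 + closedForm q r 0) + 0 + closedForm q (suc r) 0 ∎
  where open ≡-Reasoning
closedForm-suc q r (suc k) = begin
  sumBelow (suc q) (λ t → (suc q C suc t) * (2 * A t))
    ≡⟨ sumBelow-cong (suc q) (λ t _ → trans (cong (_* (2 * A t)) (sym (nCk+nC[k+1]≡[n+1]C[k+1] q t))) (*-distribʳ-+ (2 * A t) (q C t) (q C suc t))) ⟩
  sumBelow (suc q) (λ t → (q C t) * (2 * A t) + (q C suc t) * (2 * A t))
    ≡⟨ sumBelow-+ (suc q) (λ t → (q C t) * (2 * A t)) (λ t → (q C suc t) * (2 * A t)) ⟩
  sumBelow (suc q) (λ t → (q C t) * (2 * A t)) + sumBelow (suc q) (λ t → (q C suc t) * (2 * A t))
    ≡⟨ cong₂ _+_ (cong ((q C 0) * (2 * A 0) +_) same-r) (trans (sumBelow-last q _) (cong₂ _+_ next-r (cong (_* (2 * A q)) (k>n⇒nCk≡0 (n<1+n q))))) ⟩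
  (q C 0) * (2 * completionsAbove (r + q) k) + (closedForm q r (suc k) + closedForm q r k) + (closedForm q (suc r) (suc k) + 0)
    ≡⟨ +-*-Solver.solve 4 (λ e a b c → con 1 :* (con 2 :* e) :+ (a :+ b) :+ (c :+ con 0) := (e :+ a) :+ (e :+ b) :+ c) refl
         (completionsAbove (r + q) k) (closedForm q r (suc k)) (closedForm q r k) (closedForm q (suc r) (suc k)) ⟩
  (completionsAbove (r + q) k + closedForm q r (suc k)) + (completionsAbove (r + q) k + closedForm q r k) + closedForm q (suc r) (suc k) ∎
  where
  open ≡-Reasoning
  open +-*-Solver using (_:+_; _:*_; _:=_; con)
  A : ℕ → ℕ
  A t = [1+t]^ t (completionsAbove (r + (q ∸ t))) k
  Eₜ : ℕ → Poly
  Eₜ t = completionsAbove (r + (q ∸ suc t))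
  same-r : sumBelow q (λ t → (q C suc t) * (2 * A (suc t))) ≡ closedForm q r (suc k) + closedForm q r k
  same-r = trans (sumBelow-cong q (λ t _ → trans (cong ((q C suc t) *_) (*-distribˡ-+ 2 ([1+t]^ t (Eₜ t) k) (shift ([1+t]^ t (Eₜ t)) k)))
                                                 (*-distribˡ-+ (q C suc t) (2 * [1+t]^ t (Eₜ t) k) _)))
                 (sumBelow-+ q (λ t → (q C suc t) * (2 * [1+t]^ t (Eₜ t) k)) (λ t → (q C suc t) * (2 * shift ([1+t]^ t (Eₜ t)) k)))
  next-r : sumBelow q (λ t → (q C suc t) * (2 * A t)) ≡ closedForm q (suc r) (suc k)
  next-r = sumBelow-cong q (λ t t<q → cong (λ z → (q C suc t) * (2 * [1+t]^ t (completionsAbove z) k))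
                                           (trans (cong (r +_) (∸≡suc∸suc q t t<q)) (+-suc r (q ∸ suc t))))

-- With p > 0 a new run starts at a value below the last letter, which leaves every unused value
-- above it (completionsAbove); Pascal's rule then closes the induction on q.
continuations≈closedForm : ∀ q r m → m ≡ r + q → sumSplits q (λ x y → eitherSign (completions m) (x + suc r) y) ≈ closedForm q r
continuations≈closedForm zero    r m       eq k = refl
continuations≈closedForm (suc q) r zero    eq k = contradiction (trans eq (+-suc r q)) 0≢1+n
continuations≈closedForm (suc q) r (suc m) eq k = begin
  eitherSign (completions (suc m)) (suc r) q k + sumSplits q (λ x y → eitherSign (completions (suc m)) (suc x + suc r) y) k
    ≡⟨ cong (eitherSign (completions (suc m)) (suc r) q k +_) (sumSplits-cong q (λ x y k′ → cong (λ z → eitherSign (completions (suc m)) z y k′) (sym (+-suc x (suc r)))) k) ⟩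
  eitherSign (completions (suc m)) (suc r) q k + sumSplits q (λ x y → eitherSign (completions (suc m)) (x + suc (suc r)) y) k
    ≡⟨ cong₂ _+_ (cong₂ _+_ (cong₂ _+_ (cong (λ z → shift (completions m 0 z true) k) (sym m≡r+q)) (continuations≈closedForm q r m m≡r+q k))
                            (shift-cong (λ k′ → cong₂ _+_ (cong (λ z → completions m 0 z true k′) (sym m≡r+q)) (continuations≈closedForm q r m m≡r+q k′)) k))
                 (continuations≈closedForm q (suc r) (suc m) (cong suc m≡r+q) k) ⟩
  (shift (completionsAbove m) k + closedForm q r k) + shift (completionsAbove m ⊕ closedForm q r) k + closedForm q (suc r) k
    ≡⟨ cong (λ z → (shift (completionsAbove z) k + closedForm q r k) + shift (completionsAbove z ⊕ closedForm q r) k + closedForm q (suc r) k) m≡r+q ⟩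
  (shift (completionsAbove (r + q)) k + closedForm q r k) + shift (completionsAbove (r + q) ⊕ closedForm q r) k + closedForm q (suc r) k
    ≡⟨ sym (closedForm-suc q r k) ⟩
  closedForm (suc q) r k ∎
  where
  open ≡-Reasoning
  m≡r+q : m ≡ r + q
  m≡r+q = suc-injective (trans eq (+-suc r q))

descentPoly-suc : ∀ m → descentPoly (suc m) ≈ completionsAbove m
descentPoly-suc m k = trans (+-identityʳ _) (cong (λ z → completions m 0 z true k) (+-identityʳ m))

completionsAbove-suc : ∀ m → completionsAbove (suc m) ≈ (completionsAbove m ⊕ shift (completionsAbove m)) ⊕ closedForm m 0
completionsAbove-suc m k =
  cong₂ _+_ (cong (completionsAbove m k +_) (shift-cong (completions-sign m m false true) k))
            (trans (sumSplits-cong m (λ x y k′ → cong (λ z → eitherSign (completions m) z y k′) (sym (+-suc x 0))) k)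
                   (continuations≈closedForm m 0 m refl k))

descentPoly-recurrence : ∀ m → descentPoly (suc (suc m))
  ≈ (shift (descentPoly (suc m)) ⊕ descentPoly (suc m)) ⊕ (λ k → 2 * sumBelow m (λ t → (m C suc t) * shift ([1+t]^ t (descentPoly (m ∸ t))) k))
descentPoly-recurrence m k = begin
  descentPoly (suc (suc m)) k                                         ≡⟨ descentPoly-suc (suc m) k ⟩
  completionsAbove (suc m) k                                          ≡⟨ completionsAbove-suc m k ⟩
  (completionsAbove m k + shift (completionsAbove m) k) + closedForm m 0 k
    ≡⟨ cong₂ _+_ (trans (+-comm (completionsAbove m k) _) (sym (cong₂ _+_ (shift-cong (descentPoly-suc m) k) (descentPoly-suc m k)))) closedForm-descentPoly ⟩
  (shift (descentPoly (suc m)) k + descentPoly (suc m) k) + 2 * sumBelow m (λ t → (m C suc t) * shift ([1+t]^ t (descentPoly (m ∸ t))) k) ∎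
  where
  open ≡-Reasoning
  closedForm-descentPoly : closedForm m 0 k ≡ 2 * sumBelow m (λ t → (m C suc t) * shift ([1+t]^ t (descentPoly (m ∸ t))) k)
  closedForm-descentPoly =
    trans (sumBelow-cong m (λ t t<m → trans (*-x∙yz≈y∙xz (m C suc t) 2 _)
            (cong (λ z → 2 * ((m C suc t) * z))
                  (shift-cong ([1+t]^-cong t (λ k′ → trans (sym (descentPoly-suc (m ∸ suc t) k′)) (cong (λ z → descentPoly z k′) (sym (∸≡suc∸suc m t t<m))))) k))))
          (sumBelow-* m 2 (λ t → (m C suc t) * shift ([1+t]^ t (descentPoly (m ∸ t))) k))

∧-true : ∀ {a b} → a ≡ true → b ≡ true → a ∧ b ≡ true
∧-true refl refl = refl

true≢false : true ≢ false
true≢false ()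

true⇔true⇒≡ : ∀ {a b : Bool} → (a ≡ true → b ≡ true) → (b ≡ true → a ≡ true) → a ≡ b
true⇔true⇒≡ {false} {false} _ _ = refl
true⇔true⇒≡ {false} {true}  _ f = f refl
true⇔true⇒≡ {true}  {false} t _ = sym (t refl)
true⇔true⇒≡ {true}  {true}  _ _ = refl

∨-true : ∀ a {b} → b ≡ true → a ∨ b ≡ true
∨-true a refl = ∨-zeroʳ a

∨-true-cases : ∀ a b → a ∨ b ≡ true → a ≡ true ⊎ b ≡ true
∨-true-cases true  b _ = inj₁ refl
∨-true-cases false b b≡true = inj₂ b≡true

<ᵇ≡true⇒< : ∀ m n → (m <ᵇ n) ≡ true → m < n
<ᵇ≡true⇒< m n = <ᵇ⇒< m n ∘ Equivalence.from T-≡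

<⇒<ᵇ≡true : ∀ {m n} → m < n → (m <ᵇ n) ≡ true
<⇒<ᵇ≡true = Equivalence.to T-≡ ∘ <⇒<ᵇ

<ᵇ≡false⇒≥ : ∀ m n → (m <ᵇ n) ≡ false → n ≤ m
<ᵇ≡false⇒≥ m n m≮ᵇn = ≮⇒≥ (λ m<n → true≢false (trans (sym (<⇒<ᵇ≡true m<n)) m≮ᵇn))

≥⇒<ᵇ≡false : ∀ {m n} → n ≤ m → (m <ᵇ n) ≡ false
≥⇒<ᵇ≡false {m} {n} n≤m with m <ᵇ n in m<ᵇn
... | true  = contradiction (<ᵇ≡true⇒< m n m<ᵇn) (≤⇒≯ n≤m)
... | false = refl

<ᵇ-asym : ∀ x y → (x <ᵇ y) ≡ true → (y <ᵇ x) ≡ false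
<ᵇ-asym x y x<y = ≥⇒<ᵇ≡false (<⇒≤ (<ᵇ≡true⇒< x y x<y))

≡ᵇ≡true⇒≡ : ∀ m n → (m ≡ᵇ n) ≡ true → m ≡ n
≡ᵇ≡true⇒≡ m n = ≡ᵇ⇒≡ m n ∘ Equivalence.from T-≡

≡⇒≡ᵇ≡true : ∀ {m n} → m ≡ n → (m ≡ᵇ n) ≡ true
≡⇒≡ᵇ≡true {m} {n} = Equivalence.to T-≡ ∘ ≡⇒≡ᵇ m n

≡ᵇ-refl : ∀ n → (n ≡ᵇ n) ≡ true
≡ᵇ-refl n = ≡⇒≡ᵇ≡true {n} refl

≢⇒≡ᵇ≡false : ∀ {m n} → m ≢ n → (m ≡ᵇ n) ≡ false
≢⇒≡ᵇ≡false {m} {n} m≢n with m ≡ᵇ n in m≡ᵇn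
... | true  = contradiction (≡ᵇ≡true⇒≡ m n m≡ᵇn) m≢n
... | false = refl

≤pred⇒< : ∀ {v k} → 1 ≤ k → v ≤ pred k → v < k
≤pred⇒< {k = suc k} _ v≤k = s≤s v≤k

∈-concatMap-intro : ∀ {A B : Set} (f : A → List B) {x y xs} → x ∈ xs → y ∈ f x → y ∈ concatMap f xs
∈-concatMap-intro f x∈xs y∈fx = ∈-concatMap⁺ f (lose x∈xs y∈fx)

∈-concatMap-elim : ∀ {A B : Set} (f : A → List B) {y} xs → y ∈ concatMap f xs → ∃ λ x → x ∈ xs × y ∈ f x
∈-concatMap-elim f xs y∈ = find (∈-concatMap⁻ f {xs} y∈)

any-true : ∀ {A : Set} (P : A → Bool) {x} xs → x ∈ xs → P x ≡ true → any P xs ≡ true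
any-true P (x ∷ xs) (here refl) Px rewrite Px = refl
any-true P (y ∷ xs) (there x∈xs) Px with P y
... | true  = refl
... | false = any-true P xs x∈xs Px

any-false : ∀ {A : Set} (P : A → Bool) xs → (∀ x → x ∈ xs → P x ≡ false) → any P xs ≡ false
any-false P []       ¬P = refl
any-false P (x ∷ xs) ¬P rewrite ¬P x (here refl) = any-false P xs (λ y y∈xs → ¬P y (there y∈xs))

all-applyUpTo-elim : ∀ (P : ℕ → Bool) f n → all P (applyUpTo f n) ≡ true → ∀ i → i < n → P (f i) ≡ true
all-applyUpTo-elim P f (suc n) all-P zero    _         = ∧-conicalˡ (P (f 0)) _ all-P
all-applyUpTo-elim P f (suc n) all-P (suc i) (s≤s i<n) = all-applyUpTo-elim P (f ∘ suc) n (∧-conicalʳ (P (f 0)) _ all-P) i i<n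

all-applyUpTo-intro : ∀ (P : ℕ → Bool) f n → (∀ i → i < n → P (f i) ≡ true) → all P (applyUpTo f n) ≡ true
all-applyUpTo-intro P f zero    _   = refl
all-applyUpTo-intro P f (suc n) P-f = ∧-true (P-f 0 (s≤s z≤n)) (all-applyUpTo-intro P (f ∘ suc) n (λ i i<n → P-f (suc i) (s≤s i<n)))

elemℕ⇒∈ : ∀ a xs → elemℕ a xs ≡ true → a ∈ xs
elemℕ⇒∈ a (x ∷ xs) a∈ with a ≡ᵇ x in a≡x
... | true  = here (≡ᵇ≡true⇒≡ a x a≡x)
... | false = there (elemℕ⇒∈ a xs a∈)

∈⇒elemℕ : ∀ a xs → a ∈ xs → elemℕ a xs ≡ true
∈⇒elemℕ a (x ∷ xs) (here refl) rewrite ≡ᵇ-refl a = refl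
∈⇒elemℕ a (x ∷ xs) (there a∈)  = ∨-true (a ≡ᵇ x) (∈⇒elemℕ a xs a∈)


-- Merging-free partitions and runs

isPositive : ℤ → Bool
isPositive x = minPositive (x ∷ [])

minPositive-∷ : ∀ x xs → minPositive (x ∷ xs) ≡ isPositive x
minPositive-∷ +0        xs = refl
minPositive-∷ +[1+ n ] xs = refl
minPositive-∷ -[1+ n ]  xs = refl

-- Merging-freeness forces the blocks to be the maximal runs of increasing absolute value.
addToRuns : ℤ → List (List ℤ) → List (List ℤ)
addToRuns x []       = (x ∷ []) ∷ []
addToRuns x (c ∷ cs) = if ∣ x ∣ <ᵇ minAbs c then (x ∷ c) ∷ cs else (x ∷ []) ∷ c ∷ cs

runs : List ℤ → List (List ℤ)
runs []       = []
runs (x ∷ xs) = addToRuns x (runs xs)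

runs∈splits : ∀ σ → runs σ ∈ splits σ
runs∈splits [] = here refl
runs∈splits (x ∷ xs) with runs xs | runs∈splits xs
... | []     | r∈s = ∈-concatMap-intro _ r∈s (here refl)
... | c ∷ cs | r∈s with ∣ x ∣ <ᵇ minAbs c
...   | true  = ∈-concatMap-intro _ r∈s (there (here refl))
...   | false = ∈-concatMap-intro _ r∈s (here refl)

[]∷∉splits : ∀ σ bs → ([] ∷ bs) ∈ splits σ → ⊥
[]∷∉splits []       bs (here ())
[]∷∉splits []       bs (there ())
[]∷∉splits (y ∷ ys) bs []∷bs∈ with ∈-concatMap-elim _ (splits ys) []∷bs∈
... | []     , _ , here ()
... | []     , _ , there ()
... | c ∷ cs , _ , here ()
... | c ∷ cs , _ , there (here ())
... | c ∷ cs , _ , there (there ())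

mergingFree-∷ : ∀ x y ys bs → mergingFree ((x ∷ y ∷ ys) ∷ bs) ≡ mergingFree ((y ∷ ys) ∷ bs)
mergingFree-∷ x y ys []       = refl
mergingFree-∷ x y ys (b ∷ bs) = refl

mergingFree-split≡runs : ∀ σ π → π ∈ splits σ → all absStrictIncr π ≡ true → mergingFree π ≡ true → π ≡ runs σ
mergingFree-split≡runs []       π (here refl) _ _ = refl
mergingFree-split≡runs (x ∷ xs) π π∈ incr mf with ∈-concatMap-elim _ (splits xs) π∈
... | [] , ρ∈ , here refl = cong (addToRuns x) (mergingFree-split≡runs xs [] ρ∈ refl refl)
... | b ∷ bs , ρ∈ , here refl =
  trans (new-run (not-injective (∧-conicalˡ _ _ mf))) (cong (addToRuns x) (mergingFree-split≡runs xs (b ∷ bs) ρ∈ incr (∧-conicalʳ _ _ mf)))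
  where
  new-run : (∣ x ∣ <ᵇ minAbs b) ≡ false → ((x ∷ []) ∷ b ∷ bs) ≡ addToRuns x (b ∷ bs)
  new-run x≮b rewrite x≮b = refl
... | [] ∷ bs , ρ∈ , there (here refl) = ⊥-elim ([]∷∉splits xs bs ρ∈)
... | (y ∷ ys) ∷ bs , ρ∈ , there (here refl) =
  trans (same-run x<y) (cong (addToRuns x) (mergingFree-split≡runs xs ((y ∷ ys) ∷ bs) ρ∈ incr′ (trans (sym (mergingFree-∷ x y ys bs)) mf)))
  where
  incr-head : (∣ x ∣ <ᵇ ∣ y ∣) ∧ absStrictIncr (y ∷ ys) ≡ true
  incr-head = ∧-conicalˡ _ (all absStrictIncr bs) incr
  x<y : (∣ x ∣ <ᵇ ∣ y ∣) ≡ true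
  x<y = ∧-conicalˡ _ _ incr-head
  incr′ : all absStrictIncr ((y ∷ ys) ∷ bs) ≡ true
  incr′ = ∧-true (∧-conicalʳ (∣ x ∣ <ᵇ ∣ y ∣) _ incr-head) (∧-conicalʳ _ _ incr)
  same-run : (∣ x ∣ <ᵇ ∣ y ∣) ≡ true → ((x ∷ y ∷ ys) ∷ bs) ≡ addToRuns x ((y ∷ ys) ∷ bs)
  same-run x<y rewrite x<y = refl

mergingFreeTypeB : ℕ → List (List ℤ) → Bool
mergingFreeTypeB n π = isTypeBPartition n π ∧ mergingFree π

validBlocks⇒absStrictIncr : ∀ π → all validBlock π ≡ true → all absStrictIncr π ≡ true
validBlocks⇒absStrictIncr []      _     = refl
validBlocks⇒absStrictIncr (b ∷ π) valid =
  ∧-true (∧-conicalˡ _ _ (∧-conicalˡ _ _ valid)) (validBlocks⇒absStrictIncr π (∧-conicalʳ _ _ valid))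

inR≡runs : ∀ n σ → inR n σ ≡ mergingFreeTypeB n (runs σ)
inR≡runs n σ with mergingFreeTypeB n (runs σ) in runs-ok
... | true  = any-true (mergingFreeTypeB n) (splits σ) (runs∈splits σ) runs-ok
... | false = any-false (mergingFreeTypeB n) (splits σ) only-runs
  where
  only-runs : ∀ π → π ∈ splits σ → mergingFreeTypeB n π ≡ false
  only-runs π π∈ with mergingFreeTypeB n π in π-ok
  ... | false = refl
  ... | true with mergingFree-split≡runs σ π π∈ (validBlocks⇒absStrictIncr π (∧-conicalˡ _ _ (∧-conicalˡ _ _ π-ok))) (∧-conicalʳ _ _ π-ok)
  ...   | refl = contradiction (trans (sym π-ok) runs-ok) true≢false

isSignedPermutation : ℕ → List ℤ → Bool
isSignedPermutation n σ = (length (map ∣_∣ σ) ≡ᵇ n) ∧ all (λ i → elemℕ (suc i) (map ∣_∣ σ)) (upTo n)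

concat-addToRuns : ∀ x ρ → concat (addToRuns x ρ) ≡ x ∷ concat ρ
concat-addToRuns x []       = refl
concat-addToRuns x (c ∷ cs) with ∣ x ∣ <ᵇ minAbs c
... | true  = refl
... | false = refl

concat-runs : ∀ σ → concat (runs σ) ≡ σ
concat-runs []       = refl
concat-runs (x ∷ xs) = trans (concat-addToRuns x (runs xs)) (cong (x ∷_) (concat-runs xs))

mergingFree-addToRuns : ∀ x ρ → mergingFree ρ ≡ true → mergingFree (addToRuns x ρ) ≡ true
mergingFree-addToRuns x []       mf = refl
mergingFree-addToRuns x (c ∷ cs) mf with ∣ x ∣ <ᵇ minAbs c in x<c
mergingFree-addToRuns x ([] ∷ cs)       mf | true  = contradiction x<c (λ ())
mergingFree-addToRuns x ((y ∷ ys) ∷ cs) mf | true  = trans (mergingFree-∷ x y ys cs) mf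
mergingFree-addToRuns x (c ∷ cs)        mf | false rewrite x<c = mf

mergingFree-runs : ∀ σ → mergingFree (runs σ) ≡ true
mergingFree-runs []       = refl
mergingFree-runs (x ∷ xs) = mergingFree-addToRuns x (runs xs) (mergingFree-runs xs)

absStrictIncr-addToRuns : ∀ x ρ → all absStrictIncr ρ ≡ true → all absStrictIncr (addToRuns x ρ) ≡ true
absStrictIncr-addToRuns x []       incr = refl
absStrictIncr-addToRuns x (c ∷ cs) incr with ∣ x ∣ <ᵇ minAbs c in x<c
absStrictIncr-addToRuns x ([] ∷ cs)       incr | true  = contradiction x<c (λ ())
absStrictIncr-addToRuns x ((y ∷ ys) ∷ cs) incr | true  rewrite x<c = incr
absStrictIncr-addToRuns x (c ∷ cs)        incr | false = incr

absStrictIncr-runs : ∀ σ → all absStrictIncr (runs σ) ≡ true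
absStrictIncr-runs []       = refl
absStrictIncr-runs (x ∷ xs) = absStrictIncr-addToRuns x (runs xs) (absStrictIncr-runs xs)

validBlocks≡minPositive : ∀ π → all absStrictIncr π ≡ true → all validBlock π ≡ all minPositive π
validBlocks≡minPositive []      _    = refl
validBlocks≡minPositive (b ∷ π) incr rewrite ∧-conicalˡ (absStrictIncr b) _ incr =
  cong (minPositive b ∧_) (validBlocks≡minPositive π (∧-conicalʳ (absStrictIncr b) _ incr))

headsAbove : ℕ → List (List ℤ) → Bool
headsAbove h []       = true
headsAbove h (c ∷ cs) = minPositive c ∧ (h <ᵇ minAbs c) ∧ headsAbove (minAbs c) cs

headsIncreasing : List (List ℤ) → Bool
headsIncreasing []       = true
headsIncreasing (c ∷ cs) = minPositive c ∧ headsAbove (minAbs c) cs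

positive∧minsIncr≡headsAbove : ∀ c cs → all minPositive (c ∷ cs) ∧ minsIncr (c ∷ cs) ≡ minPositive c ∧ headsAbove (minAbs c) cs
positive∧minsIncr≡headsAbove c []        = ∧-identityʳ (minPositive c ∧ true)
positive∧minsIncr≡headsAbove c (c′ ∷ cs) = begin
  (pc ∧ (pc′ ∧ pcs)) ∧ (lt ∧ mi)  ≡⟨ solve 5 (λ a b e l f → (a :* (b :* e)) :* (l :* f) := a :* (l :* ((b :* e) :* f))) refl pc pc′ pcs lt mi ⟩
  pc ∧ (lt ∧ ((pc′ ∧ pcs) ∧ mi))  ≡⟨ cong (λ z → pc ∧ (lt ∧ z)) (positive∧minsIncr≡headsAbove c′ cs) ⟩
  pc ∧ (lt ∧ (pc′ ∧ ha))          ≡⟨ solve 4 (λ a l b h → a :* (l :* (b :* h)) := a :* (b :* (l :* h))) refl pc lt pc′ ha ⟩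
  pc ∧ (pc′ ∧ (lt ∧ ha))          ∎
  where
  open ≡-Reasoning
  open ∨-∧-Solver using (solve; _:*_; _:=_)
  pc pc′ pcs lt mi ha : Bool
  pc  = minPositive c
  pc′ = minPositive c′
  pcs = all minPositive cs
  lt  = minAbs c <ᵇ minAbs c′
  mi  = minsIncr (c′ ∷ cs)
  ha  = headsAbove (minAbs c′) cs

positive∧minsIncr≡headsIncreasing : ∀ π → all minPositive π ∧ minsIncr π ≡ headsIncreasing π
positive∧minsIncr≡headsIncreasing []       = refl
positive∧minsIncr≡headsIncreasing (c ∷ cs) = positive∧minsIncr≡headsAbove c cs

runHeadsAfter : ℤ → ℕ → List ℤ → Bool
runHeadsAfter a h []      = true
runHeadsAfter a h (b ∷ w) =
  if ∣ a ∣ <ᵇ ∣ b ∣ then runHeadsAfter b h w else (isPositive b ∧ (h <ᵇ ∣ b ∣) ∧ runHeadsAfter b ∣ b ∣ w)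

runHeadsOK : List ℤ → Bool
runHeadsOK []      = true
runHeadsOK (b ∷ w) = isPositive b ∧ runHeadsAfter b ∣ b ∣ w

headsAfter : ℤ → ℕ → List (List ℤ) → Bool
headsAfter a h []       = true
headsAfter a h (c ∷ cs) =
  if ∣ a ∣ <ᵇ minAbs c then headsAbove h cs else (minPositive c ∧ (h <ᵇ minAbs c) ∧ headsAbove (minAbs c) cs)

headsAfter-addToRuns : ∀ a h y ρ →
  (if ∣ a ∣ <ᵇ ∣ y ∣ then headsAfter y h ρ else (isPositive y ∧ (h <ᵇ ∣ y ∣) ∧ headsAfter y ∣ y ∣ ρ)) ≡ headsAfter a h (addToRuns y ρ)
headsAfter-addToRuns a h y []       = refl
headsAfter-addToRuns a h y (c ∷ cs) with ∣ y ∣ <ᵇ minAbs c in y<c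
... | true  rewrite minPositive-∷ y c = refl
... | false rewrite y<c = refl

runHeadsAfter≡headsAfter : ∀ w a h → runHeadsAfter a h w ≡ headsAfter a h (runs w)
runHeadsAfter≡headsAfter []       a h = refl
runHeadsAfter≡headsAfter (y ∷ ys) a h rewrite runHeadsAfter≡headsAfter ys y h | runHeadsAfter≡headsAfter ys y ∣ y ∣ =
  headsAfter-addToRuns a h y (runs ys)

runHeadsOK≡headsIncreasing : ∀ σ → runHeadsOK σ ≡ headsIncreasing (runs σ)
runHeadsOK≡headsIncreasing []       = refl
runHeadsOK≡headsIncreasing (y ∷ ys) rewrite runHeadsAfter≡headsAfter ys y ∣ y ∣ = first-run (runs ys)
  where
  first-run : ∀ ρ → isPositive y ∧ headsAfter y ∣ y ∣ ρ ≡ headsIncreasing (addToRuns y ρ)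
  first-run []       = refl
  first-run (c ∷ cs) with ∣ y ∣ <ᵇ minAbs c in y<c
  ... | true  rewrite minPositive-∷ y c = refl
  ... | false rewrite y<c = refl

mergingFreeTypeB-runs : ∀ n σ → mergingFreeTypeB n (runs σ) ≡ runHeadsOK σ ∧ isSignedPermutation n σ
mergingFreeTypeB-runs n σ = begin
  (all validBlock ρ ∧ (minsIncr ρ ∧ isSignedPermutation n (concat ρ))) ∧ mergingFree ρ
    ≡⟨ cong₂ (λ z w → (z ∧ (minsIncr ρ ∧ isSignedPermutation n w)) ∧ mergingFree ρ) (validBlocks≡minPositive ρ (absStrictIncr-runs σ)) (concat-runs σ) ⟩
  (all minPositive ρ ∧ (minsIncr ρ ∧ isSignedPermutation n σ)) ∧ mergingFree ρ
    ≡⟨ cong ((all minPositive ρ ∧ (minsIncr ρ ∧ isSignedPermutation n σ)) ∧_) (mergingFree-runs σ) ⟩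
  (all minPositive ρ ∧ (minsIncr ρ ∧ isSignedPermutation n σ)) ∧ true
    ≡⟨ solve 3 (λ a b c → (a :* (b :* c)) :* con true := (a :* b) :* c) refl (all minPositive ρ) (minsIncr ρ) (isSignedPermutation n σ) ⟩
  (all minPositive ρ ∧ minsIncr ρ) ∧ isSignedPermutation n σ
    ≡⟨ cong (_∧ isSignedPermutation n σ) (trans (positive∧minsIncr≡headsIncreasing ρ) (sym (runHeadsOK≡headsIncreasing σ))) ⟩
  runHeadsOK σ ∧ isSignedPermutation n σ ∎
  where
  open ≡-Reasoning
  open ∨-∧-Solver using (solve; _:*_; _:=_; con)
  ρ : List (List ℤ)
  ρ = runs σ

inR≡runHeadsOK : ∀ n σ → inR n σ ≡ runHeadsOK σ ∧ isSignedPermutation n σ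
inR≡runHeadsOK n σ = trans (inR≡runs n σ) (mergingFreeTypeB-runs n σ)


-- An automaton recognising R_n^B

Covers : ℕ → List ℕ → Set
Covers n L = ∀ v → 1 ≤ v → v ≤ n → v ∈ L

InRange : ℕ → List ℤ → Set
InRange n σ = ∀ y → y ∈ σ → (1 ≤ ∣ y ∣) × (∣ y ∣ ≤ n)

AbsDistinct : List ℤ → Set
AbsDistinct σ = ∀ P y Q → σ ≡ P ++ y ∷ Q → ∣ y ∣ ∈ map ∣_∣ P → ⊥

isSignedPermutation⇒covers : ∀ n σ → isSignedPermutation n σ ≡ true → Covers n (map ∣_∣ σ)
isSignedPermutation⇒covers n σ perm (suc v) _ v<n =
  elemℕ⇒∈ (suc v) (map ∣_∣ σ) (all-applyUpTo-elim (λ i → elemℕ (suc i) (map ∣_∣ σ)) id n (∧-conicalʳ (length (map ∣_∣ σ) ≡ᵇ n) _ perm) v v<n)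

covers⇒≤length : ∀ n L → Covers n L → n ≤ length L
covers⇒≤length zero    L _   = z≤n
covers⇒≤length (suc n) L cov with ∈-∃++ (cov (suc n) (s≤s z≤n) ≤-refl)
... | P , Q , refl = subst (suc n ≤_) (sym (length-++-∷ P Q)) (s≤s (covers⇒≤length n (P ++ Q) cov′))
  where
  length-++-∷ : ∀ (P : List ℕ) Q → length (P ++ suc n ∷ Q) ≡ suc (length (P ++ Q))
  length-++-∷ P Q = trans (length-++ P) (trans (+-suc (length P) (length Q)) (cong suc (sym (length-++ P))))
  cov′ : Covers n (P ++ Q)
  cov′ v 1≤v v≤n with ∈-++⁻ P (cov v 1≤v (m≤n⇒m≤1+n v≤n))
  ... | inj₁ v∈P         = ∈-++⁺ˡ v∈P
  ... | inj₂ (here refl) = contradiction v≤n 1+n≰n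
  ... | inj₂ (there v∈Q) = ∈-++⁺ʳ P v∈Q

-- A repeated absolute value would leave only n - 1 slots for the n values of [n].
covers⇒absDistinct : ∀ n σ → length σ ≡ n → Covers n (map ∣_∣ σ) → AbsDistinct σ
covers⇒absDistinct n σ len cov P y Q refl y∈P =
  1+n≰n (subst (_≤ length P + length Q) n≡ (≤-trans (covers⇒≤length n (map ∣_∣ P ++ map ∣_∣ Q) cov′) (≤-reflexive length-PQ)))
  where
  n≡ : n ≡ suc (length P + length Q)
  n≡ = trans (sym len) (trans (length-++ P) (+-suc (length P) (length Q)))
  length-PQ : length (map ∣_∣ P ++ map ∣_∣ Q) ≡ length P + length Q
  length-PQ = trans (length-++ (map ∣_∣ P)) (cong₂ _+_ (length-map ∣_∣ P) (length-map ∣_∣ Q))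
  cov′ : Covers n (map ∣_∣ P ++ map ∣_∣ Q)
  cov′ v 1≤v v≤n with ∈-++⁻ (map ∣_∣ P) (subst (v ∈_) (map-++ ∣_∣ P (y ∷ Q)) (cov v 1≤v v≤n))
  ... | inj₁ v∈P         = ∈-++⁺ˡ v∈P
  ... | inj₂ (here refl) = ∈-++⁺ˡ y∈P
  ... | inj₂ (there v∈Q) = ∈-++⁺ʳ (map ∣_∣ P) v∈Q

insert : ℕ → (ℕ → Bool) → ℕ → Bool
insert v u x = (x ≡ᵇ v) ∨ u x

allUsed : (ℕ → Bool) → ℕ → Bool
allUsed u zero    = true
allUsed u (suc m) = u 1 ∧ allUsed (u ∘ suc) m

allUsed-elim : ∀ u m → allUsed u m ≡ true → ∀ v → 1 ≤ v → v ≤ m → u v ≡ true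
allUsed-elim u (suc m) used (suc zero)    _ _         = ∧-conicalˡ (u 1) _ used
allUsed-elim u (suc m) used (suc (suc v)) _ (s≤s v≤m) = allUsed-elim (u ∘ suc) m (∧-conicalʳ (u 1) _ used) (suc v) (s≤s z≤n) v≤m

allUsed-intro : ∀ u m → (∀ v → 1 ≤ v → v ≤ m → u v ≡ true) → allUsed u m ≡ true
allUsed-intro u zero    _    = refl
allUsed-intro u (suc m) used = ∧-true (used 1 (s≤s z≤n) (s≤s z≤n)) (allUsed-intro (u ∘ suc) m (λ v 1≤v v≤m → used (suc v) (s≤s z≤n) (s≤s v≤m)))

-- u is the set of absolute values used so far and a the last letter.
admissible : (ℕ → Bool) → ℤ → ℤ → Bool
admissible u a b = not (u ∣ b ∣) ∧ ((∣ a ∣ <ᵇ ∣ b ∣) ∨ (isPositive b ∧ allUsed u (pred ∣ b ∣)))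

accepts : ℕ → (ℕ → Bool) → ℤ → List ℤ → Bool
accepts n u a []      = allUsed u n
accepts n u a (b ∷ w) = admissible u a b ∧ accepts n (insert ∣ b ∣ u) b w

noneUsed : ℕ → Bool
noneUsed _ = false

-- A virtual letter in front of the word: all of [n] lies below it in absolute value, so the first
-- letter starts a run, and it is smaller than every letter, so it creates no descent.
start : ℕ → ℤ
start n = -[1+ n ]

isPositive⇒1≤∣∣ : ∀ b → isPositive b ≡ true → 1 ≤ ∣ b ∣
isPositive⇒1≤∣∣ +[1+ n ] _ = s≤s z≤n

runHeadsAfter-continue : ∀ a h b w → (∣ a ∣ <ᵇ ∣ b ∣) ≡ true → runHeadsAfter a h (b ∷ w) ≡ runHeadsAfter b h w
runHeadsAfter-continue a h b w a<b rewrite a<b = refl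

runHeadsAfter-newRun : ∀ a h b w → (∣ a ∣ <ᵇ ∣ b ∣) ≡ false →
  runHeadsAfter a h (b ∷ w) ≡ isPositive b ∧ (h <ᵇ ∣ b ∣) ∧ runHeadsAfter b ∣ b ∣ w
runHeadsAfter-newRun a h b w a≮b rewrite a≮b = refl

runHeadsAfter⇒above : ∀ w a h → runHeadsAfter a h w ≡ true → h ≤ ∣ a ∣ → ∀ y → y ∈ w → h < ∣ y ∣
runHeadsAfter⇒above (b ∷ w) a h heads h≤a y y∈ with ∣ a ∣ <ᵇ ∣ b ∣ in a<b
runHeadsAfter⇒above (b ∷ w) a h heads h≤a y (here refl)  | true  = ≤-<-trans h≤a (<ᵇ≡true⇒< _ _ a<b)
runHeadsAfter⇒above (b ∷ w) a h heads h≤a y (there y∈w) | true  =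
  runHeadsAfter⇒above w b h heads (≤-trans h≤a (<⇒≤ (<ᵇ≡true⇒< _ _ a<b))) y y∈w
runHeadsAfter⇒above (b ∷ w) a h heads h≤a y (here refl)  | false = <ᵇ≡true⇒< h ∣ b ∣ (∧-conicalˡ _ _ (∧-conicalʳ (isPositive b) _ heads))
runHeadsAfter⇒above (b ∷ w) a h heads h≤a y (there y∈w) | false =
  <-trans (<ᵇ≡true⇒< h ∣ b ∣ (∧-conicalˡ _ _ (∧-conicalʳ (isPositive b) _ heads)))
          (runHeadsAfter⇒above w b ∣ b ∣ (∧-conicalʳ (h <ᵇ ∣ b ∣) _ (∧-conicalʳ (isPositive b) _ heads)) ≤-refl y y∈w)

insert-sound : ∀ pre b u → (∀ v → u v ≡ true → v ∈ map ∣_∣ pre) → ∀ v → insert ∣ b ∣ u v ≡ true → v ∈ map ∣_∣ (pre ++ b ∷ [])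
insert-sound pre b u sound v v∈ rewrite map-++ ∣_∣ pre (b ∷ []) with ∨-true-cases (v ≡ᵇ ∣ b ∣) (u v) v∈
... | inj₁ v≡b rewrite ≡ᵇ≡true⇒≡ v ∣ b ∣ v≡b = ∈-++⁺ʳ (map ∣_∣ pre) (here refl)
... | inj₂ v∈u = ∈-++⁺ˡ (sound v v∈u)

insert-complete : ∀ pre b u → (∀ v → v ∈ map ∣_∣ pre → u v ≡ true) → ∀ v → v ∈ map ∣_∣ (pre ++ b ∷ []) → insert ∣ b ∣ u v ≡ true
insert-complete pre b u complete v v∈ rewrite map-++ ∣_∣ pre (b ∷ []) with ∈-++⁻ (map ∣_∣ pre) v∈
... | inj₁ v∈pre         = ∨-true (v ≡ᵇ ∣ b ∣) (complete v v∈pre)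
... | inj₂ (here refl) rewrite ≡ᵇ-refl ∣ b ∣ = refl

insert-self : ∀ v u → insert v u v ≡ true
insert-self v u rewrite ≡ᵇ-refl v = refl

admissible⇒unused : ∀ u a b → admissible u a b ≡ true → u ∣ b ∣ ≡ false
admissible⇒unused u a b adm = not-injective (∧-conicalˡ (not (u ∣ b ∣)) _ adm)

admissible-newRun : ∀ u a b → (∣ a ∣ <ᵇ ∣ b ∣) ≡ false → admissible u a b ≡ true → (isPositive b ≡ true) × (allUsed u (pred ∣ b ∣) ≡ true)
admissible-newRun u a b a≮b adm with ∨-true-cases (∣ a ∣ <ᵇ ∣ b ∣) _ (∧-conicalʳ (not (u ∣ b ∣)) _ adm)
... | inj₁ a<b   = contradiction (trans (sym a<b) a≮b) true≢false
... | inj₂ fresh = ∧-conicalˡ (isPositive b) _ fresh , ∧-conicalʳ (isPositive b) _ fresh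

-- An unused smaller value would have to occur later, but the later letters all exceed ∣ b ∣ in
-- absolute value.
newRun⇒belowUsed : ∀ n σ pre b w u → Covers n (map ∣_∣ σ) → σ ≡ pre ++ b ∷ w → (∀ v → v ∈ map ∣_∣ pre → u v ≡ true) →
  isPositive b ≡ true → ∣ b ∣ ≤ n → runHeadsAfter b ∣ b ∣ w ≡ true → allUsed u (pred ∣ b ∣) ≡ true
newRun⇒belowUsed n σ pre b w u cov σ≡ complete b-positive b≤n heads = allUsed-intro u (pred ∣ b ∣) used
  where
  used : ∀ v → 1 ≤ v → v ≤ pred ∣ b ∣ → u v ≡ true
  used v 1≤v v≤b with ∈-++⁻ (map ∣_∣ pre) (subst (v ∈_) (map-++ ∣_∣ pre (b ∷ w)) (subst (λ z → v ∈ map ∣_∣ z) σ≡ (cov v 1≤v v≤n)))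
    where
    v<b : v < ∣ b ∣
    v<b = ≤pred⇒< (isPositive⇒1≤∣∣ b b-positive) v≤b
    v≤n : v ≤ n
    v≤n = ≤-trans (<⇒≤ v<b) b≤n
  ... | inj₁ v∈pre       = complete v v∈pre
  ... | inj₂ (here refl) = contradiction (≤pred⇒< (isPositive⇒1≤∣∣ b b-positive) v≤b) (<-irrefl refl)
  ... | inj₂ (there v∈w) with ∈-map⁻ ∣_∣ v∈w
  ...   | y , y∈w , refl = contradiction (runHeadsAfter⇒above w b ∣ b ∣ heads ≤-refl y y∈w) (<-asym (≤pred⇒< (isPositive⇒1≤∣∣ b b-positive) v≤b))

runHeads⇒accepts : ∀ n σ → Covers n (map ∣_∣ σ) → AbsDistinct σ →
  ∀ w pre u a h → σ ≡ pre ++ w → (∀ v → u v ≡ true → v ∈ map ∣_∣ pre) → (∀ v → v ∈ map ∣_∣ pre → u v ≡ true) →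
  runHeadsAfter a h w ≡ true → h ≤ ∣ a ∣ → InRange n w → accepts n u a w ≡ true
runHeads⇒accepts n σ cov distinct [] pre u a h σ≡ sound complete _ _ _ =
  allUsed-intro u n (λ v 1≤v v≤n → complete v (subst (λ z → v ∈ map ∣_∣ z) (trans σ≡ (++-identityʳ pre)) (cov v 1≤v v≤n)))
runHeads⇒accepts n σ cov distinct (b ∷ w) pre u a h σ≡ sound complete heads h≤a range with u ∣ b ∣ in b-used
... | true = ⊥-elim (distinct pre b w σ≡ (sound _ b-used))
... | false with ∣ a ∣ <ᵇ ∣ b ∣ in a<b
...   | true = runHeads⇒accepts n σ cov distinct w (pre ++ b ∷ []) (insert ∣ b ∣ u) b h (trans σ≡ (sym (++-assoc pre (b ∷ []) w)))
                 (insert-sound pre b u sound) (insert-complete pre b u complete)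
                 heads (≤-trans h≤a (<⇒≤ (<ᵇ≡true⇒< _ _ a<b))) (λ y y∈w → range y (there y∈w))
...   | false = ∧-true (∧-true b-positive (newRun⇒belowUsed n σ pre b w u cov σ≡ complete b-positive (proj₂ (range b (here refl))) heads′))
                  (runHeads⇒accepts n σ cov distinct w (pre ++ b ∷ []) (insert ∣ b ∣ u) b ∣ b ∣ (trans σ≡ (sym (++-assoc pre (b ∷ []) w)))
                    (insert-sound pre b u sound) (insert-complete pre b u complete)
                    heads′ ≤-refl (λ y y∈w → range y (there y∈w)))
  where
  b-positive : isPositive b ≡ true
  b-positive = ∧-conicalˡ (isPositive b) _ heads
  heads′ : runHeadsAfter b ∣ b ∣ w ≡ true
  heads′ = ∧-conicalʳ (h <ᵇ ∣ b ∣) _ (∧-conicalʳ (isPositive b) _ heads)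

accepts⇒runHeadsAfter : ∀ n w u a h → accepts n u a w ≡ true →
  (h ≡ 0 ⊎ u h ≡ true) → (∀ v → 1 ≤ v → v < h → u v ≡ true) → runHeadsAfter a h w ≡ true
accepts⇒runHeadsAfter n []      u a h _   _      _     = refl
accepts⇒runHeadsAfter n (b ∷ w) u a h acc h-used below =
  step (∣ a ∣ <ᵇ ∣ b ∣) refl (∧-conicalˡ (admissible u a b) _ acc) (∧-conicalʳ (admissible u a b) _ acc)
  where
  step : ∀ x → (∣ a ∣ <ᵇ ∣ b ∣) ≡ x → admissible u a b ≡ true → accepts n (insert ∣ b ∣ u) b w ≡ true → runHeadsAfter a h (b ∷ w) ≡ true
  step true a<b adm acc′ = trans (runHeadsAfter-continue a h b w a<b)
    (accepts⇒runHeadsAfter n w (insert ∣ b ∣ u) b h acc′ (still-used h-used) (λ v 1≤v v<h → ∨-true (v ≡ᵇ ∣ b ∣) (below v 1≤v v<h)))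
    where
    still-used : h ≡ 0 ⊎ u h ≡ true → h ≡ 0 ⊎ insert ∣ b ∣ u h ≡ true
    still-used (inj₁ h≡0) = inj₁ h≡0
    still-used (inj₂ h∈u) = inj₂ (∨-true (h ≡ᵇ ∣ b ∣) h∈u)
  step false a≮b adm acc′ = trans (runHeadsAfter-newRun a h b w a≮b)
    (∧-true b-positive (∧-true (<⇒<ᵇ≡true (head-below h-used))
      (accepts⇒runHeadsAfter n w (insert ∣ b ∣ u) b ∣ b ∣ acc′ (inj₂ (insert-self ∣ b ∣ u)) below′)))
    where
    b-unused : u ∣ b ∣ ≡ false
    b-unused = admissible⇒unused u a b adm
    b-positive : isPositive b ≡ true
    b-positive = proj₁ (admissible-newRun u a b a≮b adm)
    below-used : allUsed u (pred ∣ b ∣) ≡ true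
    below-used = proj₂ (admissible-newRun u a b a≮b adm)
    below′ : ∀ v → 1 ≤ v → v < ∣ b ∣ → insert ∣ b ∣ u v ≡ true
    below′ v 1≤v v<b = ∨-true (v ≡ᵇ ∣ b ∣) (allUsed-elim u (pred ∣ b ∣) below-used v 1≤v (<⇒≤pred v<b))
    head-below : h ≡ 0 ⊎ u h ≡ true → h < ∣ b ∣
    head-below (inj₁ refl) = isPositive⇒1≤∣∣ b b-positive
    head-below (inj₂ h∈u) with <-cmp h ∣ b ∣
    ... | tri< h<b _ _    = h<b
    ... | tri≈ _ refl _   = contradiction (trans (sym h∈u) b-unused) true≢false
    ... | tri> _ _ b<h    = contradiction (trans (sym (below ∣ b ∣ (isPositive⇒1≤∣∣ b b-positive) b<h)) b-unused) true≢false

accepts⇒covered : ∀ n w u a → accepts n u a w ≡ true → ∀ v → 1 ≤ v → v ≤ n → u v ≡ true ⊎ v ∈ map ∣_∣ w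
accepts⇒covered n []      u a acc v 1≤v v≤n = inj₁ (allUsed-elim u n acc v 1≤v v≤n)
accepts⇒covered n (b ∷ w) u a acc v 1≤v v≤n with accepts⇒covered n w (insert ∣ b ∣ u) b (∧-conicalʳ (admissible u a b) _ acc) v 1≤v v≤n
... | inj₂ v∈w = inj₂ (there v∈w)
... | inj₁ v∈u′ with ∨-true-cases (v ≡ᵇ ∣ b ∣) (u v) v∈u′
...   | inj₁ v≡b = inj₂ (here (≡ᵇ≡true⇒≡ v ∣ b ∣ v≡b))
...   | inj₂ v∈u = inj₁ v∈u

runHeadsOK∧perm≡accepts : ∀ n σ → length σ ≡ n → InRange n σ →
  runHeadsOK σ ∧ isSignedPermutation n σ ≡ accepts n noneUsed (start n) σ
runHeadsOK∧perm≡accepts n σ len range = true⇔true⇒≡ to from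
  where
  after-start : ∀ σ → InRange n σ → runHeadsOK σ ≡ true → runHeadsAfter (start n) 0 σ ≡ true
  after-start []      _     _     = refl
  after-start (b ∷ w) range heads =
    trans (runHeadsAfter-newRun (start n) 0 b w (≥⇒<ᵇ≡false (m≤n⇒m≤1+n (proj₂ (range b (here refl))))))
          (subst (λ z → isPositive b ∧ z ∧ runHeadsAfter b ∣ b ∣ w ≡ true) (sym (<⇒<ᵇ≡true (proj₁ (range b (here refl))))) heads)
  to : runHeadsOK σ ∧ isSignedPermutation n σ ≡ true → accepts n noneUsed (start n) σ ≡ true
  to ok = runHeads⇒accepts n σ cov (covers⇒absDistinct n σ len cov) σ [] noneUsed (start n) 0 refl (λ v ()) (λ v ())
            (after-start σ range (∧-conicalˡ (runHeadsOK σ) _ ok)) z≤n range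
    where
    cov : Covers n (map ∣_∣ σ)
    cov = isSignedPermutation⇒covers n σ (∧-conicalʳ (runHeadsOK σ) _ ok)
  heads-from-start : ∀ σ → InRange n σ → accepts n noneUsed (start n) σ ≡ true → runHeadsOK σ ≡ true
  heads-from-start []      _     _   = refl
  heads-from-start (b ∷ w) range acc = ∧-true b-positive (∧-conicalʳ (0 <ᵇ ∣ b ∣) _ (∧-conicalʳ (isPositive b) _ heads))
    where
    start≮b : (∣ start n ∣ <ᵇ ∣ b ∣) ≡ false
    start≮b = ≥⇒<ᵇ≡false (m≤n⇒m≤1+n (proj₂ (range b (here refl))))
    b-positive : isPositive b ≡ true
    b-positive = proj₁ (admissible-newRun noneUsed (start n) b start≮b (∧-conicalˡ (admissible noneUsed (start n) b) _ acc))
    heads : isPositive b ∧ (0 <ᵇ ∣ b ∣) ∧ runHeadsAfter b ∣ b ∣ w ≡ true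
    heads = trans (sym (runHeadsAfter-newRun (start n) 0 b w start≮b)) (accepts⇒runHeadsAfter n (b ∷ w) noneUsed (start n) 0 acc (inj₁ refl) (λ v _ ()))
  from : accepts n noneUsed (start n) σ ≡ true → runHeadsOK σ ∧ isSignedPermutation n σ ≡ true
  from acc = ∧-true (heads-from-start σ range acc) (∧-true length-ok covered)
    where
    length-ok : (length (map ∣_∣ σ) ≡ᵇ n) ≡ true
    length-ok rewrite length-map ∣_∣ σ | len = ≡ᵇ-refl n
    covered : all (λ i → elemℕ (suc i) (map ∣_∣ σ)) (upTo n) ≡ true
    covered = all-applyUpTo-intro (λ i → elemℕ (suc i) (map ∣_∣ σ)) id n value-occurs
      where
      value-occurs : ∀ i → i < n → elemℕ (suc i) (map ∣_∣ σ) ≡ true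
      value-occurs i i<n with accepts⇒covered n σ noneUsed (start n) acc (suc i) (s≤s z≤n) i<n
      ... | inj₂ i∈σ = ∈⇒elemℕ (suc i) (map ∣_∣ σ) i∈σ


-- Counting accepted words

countWhere : (List ℤ → Bool) → List (List ℤ) → ℕ
countWhere P l = length (filter (λ σ → P σ Bool.≟ true) l)

countWhere-∷ : ∀ P x l → countWhere P (x ∷ l) ≡ 𝟙 (P x) + countWhere P l
countWhere-∷ P x l with P x
... | true  = refl
... | false = refl

countWhere-++ : ∀ P l₁ l₂ → countWhere P (l₁ ++ l₂) ≡ countWhere P l₁ + countWhere P l₂
countWhere-++ P []       l₂ = refl
countWhere-++ P (x ∷ l₁) l₂ = begin
  countWhere P (x ∷ l₁ ++ l₂)                  ≡⟨ countWhere-∷ P x (l₁ ++ l₂) ⟩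
  𝟙 (P x) + countWhere P (l₁ ++ l₂)            ≡⟨ cong (λ z → 𝟙 (P x) + z) (countWhere-++ P l₁ l₂) ⟩
  𝟙 (P x) + (countWhere P l₁ + countWhere P l₂) ≡⟨ sym (+-assoc (𝟙 (P x)) _ _) ⟩
  (𝟙 (P x) + countWhere P l₁) + countWhere P l₂ ≡⟨ cong (_+ countWhere P l₂) (sym (countWhere-∷ P x l₁)) ⟩
  countWhere P (x ∷ l₁) + countWhere P l₂       ∎
  where open ≡-Reasoning

countWhere-cong : ∀ P Q l → (∀ σ → σ ∈ l → P σ ≡ Q σ) → countWhere P l ≡ countWhere Q l
countWhere-cong P Q []      _   = refl
countWhere-cong P Q (x ∷ l) P≡Q = begin
  countWhere P (x ∷ l)        ≡⟨ countWhere-∷ P x l ⟩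
  𝟙 (P x) + countWhere P l    ≡⟨ cong₂ _+_ (cong 𝟙 (P≡Q x (here refl))) (countWhere-cong P Q l (λ σ σ∈l → P≡Q σ (there σ∈l))) ⟩
  𝟙 (Q x) + countWhere Q l    ≡⟨ sym (countWhere-∷ Q x l) ⟩
  countWhere Q (x ∷ l)        ∎
  where open ≡-Reasoning

countWhere-map : ∀ P (f : List ℤ → List ℤ) l → countWhere P (map f l) ≡ countWhere (P ∘ f) l
countWhere-map P f []      = refl
countWhere-map P f (x ∷ l) =
  trans (countWhere-∷ P (f x) (map f l)) (trans (cong (λ z → 𝟙 (P (f x)) + z) (countWhere-map P f l)) (sym (countWhere-∷ (P ∘ f) x l)))

countWhere-none : ∀ P l → (∀ σ → P σ ≡ false) → countWhere P l ≡ 0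
countWhere-none P []      _  = refl
countWhere-none P (x ∷ l) ¬P = trans (countWhere-∷ P x l) (cong₂ _+_ (cong 𝟙 (¬P x)) (countWhere-none P l ¬P))

countWhere-concatMap : ∀ P (f : ℤ → List (List ℤ)) (g : ℕ → ℤ) n →
  countWhere P (concatMap f (map g (upTo n))) ≡ sumBelow n (λ i → countWhere P (f (g i)))
countWhere-concatMap P f g n = go id n
  where
  go : ∀ h n → countWhere P (concatMap f (map g (applyUpTo h n))) ≡ sumBelow n (λ i → countWhere P (f (g (h i))))
  go h zero    = refl
  go h (suc n) = trans (countWhere-++ P (f (g (h 0))) _) (cong (λ z → countWhere P (f (g (h 0))) + z) (go (h ∘ suc) n))

countWhere-guard-shift : ∀ (Q : List ℤ → Bool) (D : List ℤ → ℕ) W guard c k →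
  countWhere (λ w → (guard ∧ Q w) ∧ ((𝟙 c + D w) ≡ᵇ k)) W
  ≡ (if guard then shiftIf c (λ k′ → countWhere (λ w → Q w ∧ (D w ≡ᵇ k′)) W) k else 0)
countWhere-guard-shift Q D W false c     k       = countWhere-none _ W (λ _ → refl)
countWhere-guard-shift Q D W true  false k       = refl
countWhere-guard-shift Q D W true  true  zero    = countWhere-none _ W (λ w → ∧-zeroʳ (Q w))
countWhere-guard-shift Q D W true  true  (suc k) = refl

signedAlphabet-inRange : ∀ n y → y ∈ signedAlphabet n → (1 ≤ ∣ y ∣) × (∣ y ∣ ≤ n)
signedAlphabet-inRange n y y∈ with ∈-++⁻ (map (λ i → +[1+ i ]) (upTo n)) y∈
... | inj₁ y∈pos with ∈-map⁻ (λ i → +[1+ i ]) y∈pos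
...   | i , i∈ , refl = s≤s z≤n , ∈-upTo⁻ i∈
signedAlphabet-inRange n y y∈ | inj₂ y∈neg with ∈-map⁻ -[1+_] y∈neg
...   | i , i∈ , refl = s≤s z≤n , ∈-upTo⁻ i∈

wordsOver-shape : ∀ B m σ → σ ∈ wordsOver B m → (length σ ≡ m) × (∀ y → y ∈ σ → y ∈ B)
wordsOver-shape B zero    σ (here refl) = refl , λ y ()
wordsOver-shape B (suc m) σ σ∈ with ∈-concatMap-elim (λ a → map (a ∷_) (wordsOver B m)) B σ∈
... | a , a∈B , σ∈a∷ with ∈-map⁻ (a ∷_) σ∈a∷
...   | σ′ , σ′∈ , refl with wordsOver-shape B m σ′ σ′∈
...     | len , letters = cong suc len , letters′
  where
  letters′ : ∀ y → y ∈ a ∷ σ′ → y ∈ B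
  letters′ y (here refl) = a∈B
  letters′ y (there y∈) = letters y y∈

des-start : ∀ n σ → InRange n σ → des (start n ∷ σ) ≡ des σ
des-start n []      _     = refl
des-start n (b ∷ w) range with b ℤ.<? start n
... | no  _   = refl
... | yes b<s = contradiction (proj₂ (range b (here refl))) (below-start b b<s)
  where
  below-start : ∀ b → b ℤ.< -[1+ n ] → ¬ (∣ b ∣ ≤ n)
  below-start -[1+ x ] (-<- n<x) x≤n = <-irrefl refl (<-≤-trans n<x (≤-trans (n≤1+n x) x≤n))

acceptedCount : ℕ → (ℕ → Bool) → ℤ → ℕ → ℕ → ℕ
acceptedCount n u a m k = countWhere (λ w → accepts n u a w ∧ (des (a ∷ w) ≡ᵇ k)) (wordsOver (signedAlphabet n) m)

d≡acceptedCount : ∀ n k → d n k ≡ acceptedCount n noneUsed (start n) n k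
d≡acceptedCount n k = countWhere-cong _ _ (wordsOver (signedAlphabet n) n) same-test
  where
  same-test : ∀ σ → σ ∈ wordsOver (signedAlphabet n) n →
    (inR n σ ∧ (des σ ≡ᵇ k)) ≡ (accepts n noneUsed (start n) σ ∧ (des (start n ∷ σ) ≡ᵇ k))
  same-test σ σ∈ with wordsOver-shape (signedAlphabet n) n σ σ∈
  ... | len , letters = cong₂ (λ x y → x ∧ (y ≡ᵇ k)) (trans (inR≡runHeadsOK n σ) (runHeadsOK∧perm≡accepts n σ len range)) (sym (des-start n σ range))
    where
    range : InRange n σ
    range y y∈ = signedAlphabet-inRange n y (letters y y∈)

-- Index j stands for the value j + 1 of [n].
isFreeAbove isFreeBelow : ℤ → (ℕ → Bool) → ℕ → Bool
isFreeAbove a u j = (∣ a ∣ <ᵇ suc j) ∧ not (u (suc j))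
isFreeBelow a u j = (suc j <ᵇ ∣ a ∣) ∧ not (u (suc j))

unusedCount : ℕ → (ℕ → Bool) → ℕ
unusedCount n u = sumBelow n (λ j → 𝟙 (not (u (suc j))))

freeBelow freeAbove : ℕ → (ℕ → Bool) → ℤ → ℕ
freeBelow n u a = sumBelow n (𝟙 ∘ isFreeBelow a u)
freeAbove n u a = sumBelow n (𝟙 ∘ isFreeAbove a u)

LastLetterUsed : ℕ → (ℕ → Bool) → ℤ → Set
LastLetterUsed n u a = ∀ v → 1 ≤ v → v ≤ n → u v ≡ false → v ≢ ∣ a ∣

lastLetterUsed-insert : ∀ n u i b → ∣ b ∣ ≡ suc i → LastLetterUsed n (insert (suc i) u) b
lastLetterUsed-insert n u i b b≡ v _ _ v-unused refl rewrite b≡ = contradiction (trans (sym (insert-self (suc i) u)) v-unused) true≢false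

free-not-above⇒below : ∀ n u a j → LastLetterUsed n u a → j < n → u (suc j) ≡ false → (∣ a ∣ <ᵇ suc j) ≡ false → (suc j <ᵇ ∣ a ∣) ≡ true
free-not-above⇒below n u a j used j<n j-free a≮j with <-cmp (suc j) ∣ a ∣
... | tri< j<a _ _ = <⇒<ᵇ≡true j<a
... | tri≈ _ j≡a _ = contradiction j≡a (used (suc j) (s≤s z≤n) j<n j-free)
... | tri> _ _ a<j = contradiction (trans (sym (<⇒<ᵇ≡true a<j)) a≮j) true≢false

-- A hypothesis (used ≡ false → above ≡ false → below ≡ true) records that an unused value differs
-- from ∣ a ∣, hence lies below or above it.
𝟙-free : ∀ used above below → (used ≡ false → above ≡ false → below ≡ true) → (above ≡ true → below ≡ false) →
  𝟙 (not used) ≡ 𝟙 (below ∧ not used) + 𝟙 (above ∧ not used)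
𝟙-free true  above below _ _ rewrite ∧-zeroʳ above | ∧-zeroʳ below = refl
𝟙-free false true  below _ above⇒¬below rewrite above⇒¬below refl = refl
𝟙-free false false below ¬above⇒below _ rewrite ¬above⇒below refl refl = refl

unusedCount≡below+above : ∀ n u a → LastLetterUsed n u a → unusedCount n u ≡ freeBelow n u a + freeAbove n u a
unusedCount≡below+above n u a used =
  trans (sumBelow-cong n (λ j j<n → 𝟙-free (u (suc j)) (∣ a ∣ <ᵇ suc j) (suc j <ᵇ ∣ a ∣)
                                          (free-not-above⇒below n u a j used j<n) (<ᵇ-asym ∣ a ∣ (suc j))))
        (sumBelow-+ n _ _)

𝟙-insert : ∀ at used → (at ≡ true → used ≡ false) → 𝟙 (not used) ≡ 𝟙 (not (at ∨ used)) + 𝟙 at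
𝟙-insert true  used at⇒free rewrite at⇒free refl = refl
𝟙-insert false used _ = sym (+-identityʳ _)

unusedCount-insert : ∀ n u i m → i < n → u (suc i) ≡ false → unusedCount n u ≡ suc m → unusedCount n (insert (suc i) u) ≡ m
unusedCount-insert n u i m i<n i-free count≡ = suc-injective (trans (sym one-less) count≡)
  where
  one-less : unusedCount n u ≡ suc (unusedCount n (insert (suc i) u))
  one-less = begin
    unusedCount n u
      ≡⟨ sumBelow-cong n (λ j _ → 𝟙-insert (j ≡ᵇ i) (u (suc j)) (λ j≡i → subst (λ z → u (suc z) ≡ false) (sym (≡ᵇ≡true⇒≡ j i j≡i)) i-free)) ⟩
    sumBelow n (λ j → 𝟙 (not ((j ≡ᵇ i) ∨ u (suc j))) + 𝟙 (j ≡ᵇ i))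
      ≡⟨ sumBelow-+ n _ _ ⟩
    unusedCount n (insert (suc i) u) + sumBelow n (λ j → 𝟙 (j ≡ᵇ i))
      ≡⟨ cong (λ z → unusedCount n (insert (suc i) u) + z) (sumBelow-≡ᵇ n i i<n) ⟩
    unusedCount n (insert (suc i) u) + 1
      ≡⟨ +-comm _ 1 ⟩
    suc (unusedCount n (insert (suc i) u)) ∎
    where open ≡-Reasoning

freeBelowAfter freeAboveAfter : ℕ → (ℕ → Bool) → ℕ → ℕ
freeBelowAfter n u i = freeBelow n (insert (suc i) u) +[1+ i ]
freeAboveAfter n u i = freeAbove n (insert (suc i) u) +[1+ i ]

𝟙-freeBelow-insert : ∀ before at used above below →
  (used ≡ false → above ≡ false → below ≡ true) → (above ≡ true → below ≡ false) →
  (before ≡ true → at ≡ false) → (before ≡ false → below ≡ false) →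
  𝟙 (before ∧ not (at ∨ used)) ≡ 𝟙 (before ∧ (above ∧ not used)) + 𝟙 (below ∧ not used)
𝟙-freeBelow-insert before at true above below _ _ _ _
  rewrite ∨-zeroʳ at | ∧-zeroʳ above | ∧-zeroʳ before | ∧-zeroʳ below = refl
𝟙-freeBelow-insert true at false true below _ above⇒¬below before⇒¬at _
  rewrite before⇒¬at refl | above⇒¬below refl = refl
𝟙-freeBelow-insert true at false false below ¬above⇒below _ before⇒¬at _
  rewrite before⇒¬at refl | ¬above⇒below refl refl = refl
𝟙-freeBelow-insert false at false above below _ _ _ ¬before⇒¬below
  rewrite ¬before⇒¬below refl = refl

𝟙-freeAbove-insert : ∀ after at used above → (after ≡ true → at ≡ false) → (after ≡ true → above ≡ true) →
  𝟙 (after ∧ not (at ∨ used)) ≡ 𝟙 (after ∧ (above ∧ not used))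
𝟙-freeAbove-insert false at used above _ _ = refl
𝟙-freeAbove-insert true  at used above after⇒¬at after⇒above rewrite after⇒¬at refl | after⇒above refl = refl

𝟙-freeBelow-insert-least : ∀ before at used → (before ≡ true → used ≡ true) → 𝟙 (before ∧ not (at ∨ used)) ≡ 0
𝟙-freeBelow-insert-least false at used _ = refl
𝟙-freeBelow-insert-least true  at used before⇒used rewrite before⇒used refl | ∨-zeroʳ at = refl

𝟙-free-insert-least : ∀ after at used →
  (at ≡ true → used ≡ false) → (at ≡ true → after ≡ false) → (after ≡ false → at ≡ false → used ≡ true) →
  𝟙 (not used) ≡ 𝟙 (after ∧ not (at ∨ used)) + 𝟙 at
𝟙-free-insert-least after true  used at⇒free at⇒¬after _ rewrite at⇒free refl | at⇒¬after refl = refl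
𝟙-free-insert-least true  false used _ _ _ = sym (+-identityʳ _)
𝟙-free-insert-least false false used _ _ ¬after⇒used rewrite ¬after⇒used refl refl = refl

freeBelowAfter-continue : ∀ n u a i → LastLetterUsed n u a → isFreeAbove a u i ≡ true →
  freeBelowAfter n u i ≡ sumBelow n (λ j → 𝟙 ((j <ᵇ i) ∧ isFreeAbove a u j)) + freeBelow n u a
freeBelowAfter-continue n u a i used i-free =
  trans (sumBelow-cong n (λ j j<n → 𝟙-freeBelow-insert (j <ᵇ i) (j ≡ᵇ i) (u (suc j)) (∣ a ∣ <ᵇ suc j) (suc j <ᵇ ∣ a ∣)
          (free-not-above⇒below n u a j used j<n) (<ᵇ-asym ∣ a ∣ (suc j))
          (λ j<i → ≢⇒≡ᵇ≡false (λ j≡i → <-irrefl j≡i (<ᵇ≡true⇒< j i j<i)))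
          (λ j≮i → ≥⇒<ᵇ≡false (<⇒≤ (<-≤-trans a<i (s≤s (<ᵇ≡false⇒≥ j i j≮i)))))))
        (sumBelow-+ n _ _)
  where
  a<i : ∣ a ∣ < suc i
  a<i = <ᵇ≡true⇒< _ _ (∧-conicalˡ (∣ a ∣ <ᵇ suc i) _ i-free)

freeAboveAfter-continue : ∀ n u a i → isFreeAbove a u i ≡ true → freeAboveAfter n u i ≡ sumBelow n (λ j → 𝟙 ((i <ᵇ j) ∧ isFreeAbove a u j))
freeAboveAfter-continue n u a i i-free =
  sumBelow-cong n (λ j j<n → 𝟙-freeAbove-insert (i <ᵇ j) (j ≡ᵇ i) (u (suc j)) (∣ a ∣ <ᵇ suc j)
    (λ i<j → ≢⇒≡ᵇ≡false (λ j≡i → <-irrefl (sym j≡i) (<ᵇ≡true⇒< i j i<j)))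
    (λ i<j → <⇒<ᵇ≡true (<-trans a<i (s≤s (<ᵇ≡true⇒< i j i<j)))))
  where
  a<i : ∣ a ∣ < suc i
  a<i = <ᵇ≡true⇒< _ _ (∧-conicalˡ (∣ a ∣ <ᵇ suc i) _ i-free)

isLeastFreeBelow : ℤ → (ℕ → Bool) → ℕ → Bool
isLeastFreeBelow a u i = isFreeBelow a u i ∧ allUsed u i

freeBelowAfter-newRun : ∀ n u a i → isLeastFreeBelow a u i ≡ true → freeBelowAfter n u i ≡ 0
freeBelowAfter-newRun n u a i least =
  sumBelow-zero n _ (λ j → 𝟙-freeBelow-insert-least (j <ᵇ i) (j ≡ᵇ i) (u (suc j))
    (λ j<i → allUsed-elim u i (∧-conicalʳ (isFreeBelow a u i) _ least) (suc j) (s≤s z≤n) (<ᵇ≡true⇒< j i j<i)))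

freeAboveAfter-newRun : ∀ n u a i m → isLeastFreeBelow a u i ≡ true → i < n → unusedCount n u ≡ suc m → freeAboveAfter n u i ≡ m
freeAboveAfter-newRun n u a i m least i<n count≡ = suc-injective (trans (sym one-less) count≡)
  where
  lower-used : allUsed u i ≡ true
  lower-used = ∧-conicalʳ (isFreeBelow a u i) _ least
  i-free : u (suc i) ≡ false
  i-free = not-injective (∧-conicalʳ (suc i <ᵇ ∣ a ∣) _ (∧-conicalˡ (isFreeBelow a u i) _ least))
  one-less : unusedCount n u ≡ suc (freeAboveAfter n u i)
  one-less = begin
    unusedCount n u
      ≡⟨ sumBelow-cong n (λ j _ → 𝟙-free-insert-least (i <ᵇ j) (j ≡ᵇ i) (u (suc j))
           (λ j≡i → subst (λ z → u (suc z) ≡ false) (sym (≡ᵇ≡true⇒≡ j i j≡i)) i-free)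
           (λ j≡i → subst (λ z → (i <ᵇ z) ≡ false) (sym (≡ᵇ≡true⇒≡ j i j≡i)) (≥⇒<ᵇ≡false {i} {i} ≤-refl))
           (λ i≮j j≢i → allUsed-elim u i lower-used (suc j) (s≤s z≤n)
                          (≤∧≢⇒< (<ᵇ≡false⇒≥ i j i≮j) (λ j≡i → contradiction (trans (sym (≡⇒≡ᵇ≡true j≡i)) j≢i) true≢false)))) ⟩
    sumBelow n (λ j → 𝟙 ((i <ᵇ j) ∧ not ((j ≡ᵇ i) ∨ u (suc j))) + 𝟙 (j ≡ᵇ i))
      ≡⟨ sumBelow-+ n _ _ ⟩
    freeAboveAfter n u i + sumBelow n (λ j → 𝟙 (j ≡ᵇ i))
      ≡⟨ cong (λ z → freeAboveAfter n u i + z) (sumBelow-≡ᵇ n i i<n) ⟩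
    freeAboveAfter n u i + 1
      ≡⟨ +-comm _ 1 ⟩
    suc (freeAboveAfter n u i) ∎
    where open ≡-Reasoning

isLeastFreeBelow≡first : ∀ a u i → isLeastFreeBelow a u i ≡ isFreeBelow a u i ∧ noneBefore (isFreeBelow a u) i
isLeastFreeBelow≡first a u i with isFreeBelow a u i in i-free
... | false = refl
... | true  = true⇔true⇒≡ to from
  where
  i<a : suc i < ∣ a ∣
  i<a = <ᵇ≡true⇒< _ _ (∧-conicalˡ (suc i <ᵇ ∣ a ∣) _ i-free)
  to : allUsed u i ≡ true → noneBefore (isFreeBelow a u) i ≡ true
  to lower-used = noneBefore-intro (isFreeBelow a u) i (λ j j<i →
    trans (cong (λ z → (suc j <ᵇ ∣ a ∣) ∧ not z) (allUsed-elim u i lower-used (suc j) (s≤s z≤n) j<i)) (∧-zeroʳ _))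
  from : noneBefore (isFreeBelow a u) i ≡ true → allUsed u i ≡ true
  from none = allUsed-intro u i used
    where
    used : ∀ v → 1 ≤ v → v ≤ i → u v ≡ true
    used (suc j) _ j<i with u (suc j) in j-used
    ... | true  = refl
    ... | false = contradiction (trans (sym j-free) (noneBefore-elim (isFreeBelow a u) i none j j<i)) true≢false
      where
      j-free : isFreeBelow a u j ≡ true
      j-free rewrite j-used | <⇒<ᵇ≡true {suc j} {∣ a ∣} (<-trans (s≤s j<i) i<a) = refl

sumBelow-select≡sumSplits : ∀ n (c : ℕ → Bool) (h : ℕ → ℕ → Poly) k →
  sumBelow n (λ i → if c i then h (sumBelow n (λ j → 𝟙 ((j <ᵇ i) ∧ c j))) (sumBelow n (λ j → 𝟙 ((i <ᵇ j) ∧ c j))) k else 0)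
  ≡ sumSplits (sumBelow n (𝟙 ∘ c)) h k
sumBelow-select≡sumSplits zero    c h k = refl
sumBelow-select≡sumSplits (suc n) c h k with c 0
... | true  = cong₂ _+_ (cong (λ z → h z (sumBelow n (𝟙 ∘ c ∘ suc)) k) (sumBelow-zero n _ (λ _ → refl)))
                        (sumBelow-select≡sumSplits n (c ∘ suc) (h ∘ suc) k)
... | false = sumBelow-select≡sumSplits n (c ∘ suc) h k

positive-above-no-descent : ∀ a i → (∣ a ∣ <ᵇ suc i) ≡ true → ⌊ +[1+ i ] ℤ.<? a ⌋ ≡ false
positive-above-no-descent a i a<i with +[1+ i ] ℤ.<? a
... | no  _          = refl
... | yes (+<+ i<a) = contradiction (<ᵇ≡true⇒< _ _ a<i) (<-asym i<a)

positive-below-descent : ∀ a i → (suc i <ᵇ ∣ a ∣) ≡ true → ⌊ +[1+ i ] ℤ.<? a ⌋ ≡ isPositive a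
positive-below-descent +0        i ()
positive-below-descent +[1+ x ] i i<a with +[1+ i ] ℤ.<? +[1+ x ]
... | yes _  = refl
... | no  i≮a = contradiction (+<+ (<ᵇ≡true⇒< _ _ i<a)) i≮a
positive-below-descent -[1+ x ]  i i<a with +[1+ i ] ℤ.<? -[1+ x ]
... | no  _  = refl
... | yes ()

negative-above-descent : ∀ a i → (∣ a ∣ <ᵇ suc i) ≡ true → ⌊ -[1+ i ] ℤ.<? a ⌋ ≡ true
negative-above-descent (ℤ.+ x)  i _   with -[1+ i ] ℤ.<? ℤ.+ x
... | yes _   = refl
... | no  i≮a = contradiction -<+ i≮a
negative-above-descent -[1+ x ] i a<i with -[1+ i ] ℤ.<? -[1+ x ]
... | yes _   = refl
... | no  i≮a = contradiction (-<- (≤-pred (<ᵇ≡true⇒< _ _ a<i))) i≮a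

positiveLetter-split : ∀ (f : Poly) k used above below lowerUsed descent positive →
  (used ≡ false → above ≡ false → below ≡ true) → (above ≡ true → below ≡ false) →
  (above ≡ true → descent ≡ false) → (below ≡ true → descent ≡ positive) →
  (if not used ∧ (above ∨ (true ∧ lowerUsed)) then shiftIf descent f k else 0)
  ≡ (if above ∧ not used then f k else 0) + (if (below ∧ not used) ∧ lowerUsed then shiftIf positive f k else 0)
positiveLetter-split f k true  above below _ _ _ _ _ _ _ rewrite ∧-zeroʳ above | ∧-zeroʳ below = refl
positiveLetter-split f k false true  below _ _ _ _ above⇒¬below above⇒¬descent _
  rewrite above⇒¬below refl | above⇒¬descent refl = sym (+-identityʳ (f k))
positiveLetter-split f k false false below _ _ _ ¬above⇒below _ _ below⇒descent
  rewrite ¬above⇒below refl refl | below⇒descent refl = refl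

negativeLetter-continue : ∀ (f : Poly) k used above lowerUsed descent → (above ≡ true → descent ≡ true) →
  (if not used ∧ (above ∨ (false ∧ lowerUsed)) then shiftIf descent f k else 0) ≡ (if above ∧ not used then shift f k else 0)
negativeLetter-continue f k used false _ _ _ rewrite ∧-zeroʳ (not used) = refl
negativeLetter-continue f k used true  _ _ above⇒descent rewrite above⇒descent refl | ∧-identityʳ (not used) = refl

firstLetterCount : ℕ → (ℕ → Bool) → ℤ → ℕ → ℤ → ℕ → ℕ
firstLetterCount n u a m b k = if admissible u a b then shiftIf ⌊ b ℤ.<? a ⌋ (acceptedCount n (insert ∣ b ∣ u) b m) k else 0

acceptedCount-suc : ∀ n u a m k → acceptedCount n u a (suc m) k
  ≡ sumBelow n (λ i → firstLetterCount n u a m +[1+ i ] k) + sumBelow n (λ i → firstLetterCount n u a m -[1+ i ] k)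
acceptedCount-suc n u a m k = begin
  countWhere P (concatMap extend (positives ++ negatives))
    ≡⟨ cong (countWhere P) (concatMap-++ extend positives negatives) ⟩
  countWhere P (concatMap extend positives ++ concatMap extend negatives)
    ≡⟨ countWhere-++ P (concatMap extend positives) (concatMap extend negatives) ⟩
  countWhere P (concatMap extend positives) + countWhere P (concatMap extend negatives)
    ≡⟨ cong₂ _+_ (countWhere-concatMap P extend (λ i → +[1+ i ]) n) (countWhere-concatMap P extend -[1+_] n) ⟩
  sumBelow n (λ i → countWhere P (extend +[1+ i ])) + sumBelow n (λ i → countWhere P (extend -[1+ i ]))
    ≡⟨ cong₂ _+_ (sumBelow-cong n (λ i _ → first-letter +[1+ i ])) (sumBelow-cong n (λ i _ → first-letter -[1+ i ])) ⟩
  sumBelow n (λ i → firstLetterCount n u a m +[1+ i ] k) + sumBelow n (λ i → firstLetterCount n u a m -[1+ i ] k) ∎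
  where
  open ≡-Reasoning
  positives negatives : List ℤ
  positives = map (λ i → +[1+ i ]) (upTo n)
  negatives = map -[1+_] (upTo n)
  W : List (List ℤ)
  W = wordsOver (signedAlphabet n) m
  P : List ℤ → Bool
  P w = accepts n u a w ∧ (des (a ∷ w) ≡ᵇ k)
  extend : ℤ → List (List ℤ)
  extend b = map (b ∷_) W
  first-letter : ∀ b → countWhere P (extend b) ≡ firstLetterCount n u a m b k
  first-letter b = trans (countWhere-map P (b ∷_) W)
    (countWhere-guard-shift (accepts n (insert ∣ b ∣ u) b) (λ w → des (b ∷ w)) W (admissible u a b) ⌊ b ℤ.<? a ⌋ k)

-- At most one value is the least free one below ∣ a ∣, and there is one exactly when some value
-- is free below.
freshStart-sum : ∀ n m u a k → LastLetterUsed n u a → unusedCount n u ≡ suc m →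
  sumBelow n (λ i → if isLeastFreeBelow a u i then shiftIf (isPositive a) (completions m (freeBelowAfter n u i) (freeAboveAfter n u i) true) k else 0)
  ≡ newRun (completions m) (freeBelow n u a) (freeAbove n u a) (isPositive a) k
freshStart-sum n m u a k used count≡ = begin
  sumBelow n (λ i → if isLeastFreeBelow a u i then shiftIf (isPositive a) (completions m (freeBelowAfter n u i) (freeAboveAfter n u i) true) k else 0)
    ≡⟨ sumBelow-cong n fresh≡ ⟩
  sumBelow n (λ i → c * 𝟙 (isLeastFreeBelow a u i))
    ≡⟨ sumBelow-* n c _ ⟩
  c * sumBelow n (λ i → 𝟙 (isLeastFreeBelow a u i))
    ≡⟨ cong (c *_) (trans (sumBelow-cong n (λ i _ → cong 𝟙 (isLeastFreeBelow≡first a u i))) (sumBelow-first n (isFreeBelow a u))) ⟩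
  c * (1 ⊓ freeBelow n u a)
    ≡⟨ fresh-total (freeBelow n u a) (freeAbove n u a) (trans (sym count≡) (unusedCount≡below+above n u a used)) ⟩
  newRun (completions m) (freeBelow n u a) (freeAbove n u a) (isPositive a) k ∎
  where
  open ≡-Reasoning
  c : ℕ
  c = shiftIf (isPositive a) (completionsAbove m) k
  fresh≡ : ∀ i → i < n →
    (if isLeastFreeBelow a u i then shiftIf (isPositive a) (completions m (freeBelowAfter n u i) (freeAboveAfter n u i) true) k else 0)
    ≡ c * 𝟙 (isLeastFreeBelow a u i)
  fresh≡ i i<n with isLeastFreeBelow a u i in least
  ... | false = sym (*-zeroʳ c)
  ... | true rewrite freeBelowAfter-newRun n u a i least | freeAboveAfter-newRun n u a i m least i<n count≡ = sym (*-identityʳ c)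
  fresh-total : ∀ p q → suc m ≡ p + q → c * (1 ⊓ p) ≡ newRun (completions m) p q (isPositive a) k
  fresh-total zero    q _  = *-zeroʳ c
  fresh-total (suc p) q eq = trans (*-identityʳ c) (cong (λ z → shiftIf (isPositive a) (completions m 0 z true) k) (suc-injective eq))

continuation-sum : ∀ n m u a k → LastLetterUsed n u a →
  sumBelow n (λ i → if isFreeAbove a u i then eitherSign (completions m) (freeBelowAfter n u i) (freeAboveAfter n u i) k else 0)
  ≡ sumSplits (freeAbove n u a) (λ x y → eitherSign (completions m) (x + freeBelow n u a) y) k
continuation-sum n m u a k used =
  trans (sumBelow-cong n ranked) (sumBelow-select≡sumSplits n (isFreeAbove a u) (λ x y → eitherSign (completions m) (x + freeBelow n u a) y) k)
  where
  ranked : ∀ i → i < n → (if isFreeAbove a u i then eitherSign (completions m) (freeBelowAfter n u i) (freeAboveAfter n u i) k else 0)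
    ≡ (if isFreeAbove a u i then eitherSign (completions m) (sumBelow n (λ j → 𝟙 ((j <ᵇ i) ∧ isFreeAbove a u j)) + freeBelow n u a)
                                                           (sumBelow n (λ j → 𝟙 ((i <ᵇ j) ∧ isFreeAbove a u j))) k else 0)
  ranked i i<n with isFreeAbove a u i in i-free
  ... | false = refl
  ... | true  = cong₂ (λ x y → eitherSign (completions m) x y k) (freeBelowAfter-continue n u a i used i-free) (freeAboveAfter-continue n u a i i-free)

unusedCount≡0⇒allUsed : ∀ n u → unusedCount n u ≡ 0 → allUsed u n ≡ true
unusedCount≡0⇒allUsed n u none-free = allUsed-intro u n used
  where
  used : ∀ v → 1 ≤ v → v ≤ n → u v ≡ true
  used (suc j) _ j<n with u (suc j) | sumBelow≡0⇒≡0 n _ none-free j j<n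
  ... | true | _ = refl

acceptedCount-empty : ∀ n u a → allUsed u n ≡ true → acceptedCount n u a 0 ≈ 1ₚ
acceptedCount-empty n u a all-used k =
  trans (countWhere-∷ (λ w → accepts n u a w ∧ (des (a ∷ w) ≡ᵇ k)) [] [])
        (trans (cong (λ b → 𝟙 (b ∧ (0 ≡ᵇ k)) + 0) all-used) (empty-word k))
  where
  empty-word : ∀ k → 𝟙 (true ∧ (0 ≡ᵇ k)) + 0 ≡ 1ₚ k
  empty-word zero    = refl
  empty-word (suc k) = refl

if-+ : ∀ (c : Bool) x y → (if c then x else 0) + (if c then y else 0) ≡ (if c then x + y else 0)
if-+ true  x y = refl
if-+ false x y = refl

acceptedCount≡completions : ∀ n m u a → LastLetterUsed n u a → unusedCount n u ≡ m →
  acceptedCount n u a m ≈ completions m (freeBelow n u a) (freeAbove n u a) (isPositive a)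
acceptedCount≡completions n zero u a _ none-free = acceptedCount-empty n u a (unusedCount≡0⇒allUsed n u none-free)
acceptedCount≡completions n (suc m) u a used count≡ k = begin
  acceptedCount n u a (suc m) k
    ≡⟨ acceptedCount-suc n u a m k ⟩
  sumBelow n (λ i → firstLetterCount n u a m +[1+ i ] k) + sumBelow n (λ i → firstLetterCount n u a m -[1+ i ] k)
    ≡⟨ cong₂ _+_ (sumBelow-cong n positive) (sumBelow-cong n negative) ⟩
  sumBelow n (λ i → continue⁺ i + fresh i) + sumBelow n continue⁻
    ≡⟨ cong (_+ sumBelow n continue⁻) (sumBelow-+ n continue⁺ fresh) ⟩
  (sumBelow n continue⁺ + sumBelow n fresh) + sumBelow n continue⁻
    ≡⟨ +-xy∙z≈y∙xz (sumBelow n continue⁺) _ _ ⟩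
  sumBelow n fresh + (sumBelow n continue⁺ + sumBelow n continue⁻)
    ≡⟨ cong (λ z → sumBelow n fresh + z) (trans (sym (sumBelow-+ n continue⁺ continue⁻)) (sumBelow-cong n (λ i _ → if-+ (isFreeAbove a u i) _ _))) ⟩
  sumBelow n fresh + sumBelow n (λ i → if isFreeAbove a u i then eitherSign (completions m) (freeBelowAfter n u i) (freeAboveAfter n u i) k else 0)
    ≡⟨ cong₂ _+_ (freshStart-sum n m u a k used count≡) (continuation-sum n m u a k used) ⟩
  completions (suc m) (freeBelow n u a) (freeAbove n u a) (isPositive a) k ∎
  where
  open ≡-Reasoning
  after : ℕ → Bool → Poly
  after i = completions m (freeBelowAfter n u i) (freeAboveAfter n u i)
  continue⁺ fresh continue⁻ : ℕ → ℕ
  continue⁺ i = if isFreeAbove a u i then after i true k else 0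
  fresh     i = if isLeastFreeBelow a u i then shiftIf (isPositive a) (after i true) k else 0
  continue⁻ i = if isFreeAbove a u i then shift (after i false) k else 0
  letter-ih : ∀ i b → i < n → ∣ b ∣ ≡ suc i → firstLetterCount n u a m b k
    ≡ (if admissible u a b
       then shiftIf ⌊ b ℤ.<? a ⌋ (completions m (freeBelow n (insert ∣ b ∣ u) b) (freeAbove n (insert ∣ b ∣ u) b) (isPositive b)) k
       else 0)
  letter-ih i b i<n b≡ with admissible u a b in adm
  ... | false = refl
  ... | true  = shiftIf-cong ⌊ b ℤ.<? a ⌋ (acceptedCount≡completions n m (insert ∣ b ∣ u) b used′ count′) k
    where
    used′ : LastLetterUsed n (insert ∣ b ∣ u) b
    used′ = subst (λ v → LastLetterUsed n (insert v u) b) (sym b≡) (lastLetterUsed-insert n u i b b≡)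
    count′ : unusedCount n (insert ∣ b ∣ u) ≡ m
    count′ = subst (λ v → unusedCount n (insert v u) ≡ m) (sym b≡)
                   (unusedCount-insert n u i m i<n (subst (λ v → u v ≡ false) b≡ (admissible⇒unused u a b adm)) count≡)
  positive : ∀ i → i < n → firstLetterCount n u a m +[1+ i ] k ≡ continue⁺ i + fresh i
  positive i i<n = trans (letter-ih i +[1+ i ] i<n refl)
    (positiveLetter-split (after i true) k (u (suc i)) (∣ a ∣ <ᵇ suc i) (suc i <ᵇ ∣ a ∣) (allUsed u i) ⌊ +[1+ i ] ℤ.<? a ⌋ (isPositive a)
      (free-not-above⇒below n u a i used i<n) (<ᵇ-asym ∣ a ∣ (suc i)) (positive-above-no-descent a i) (positive-below-descent a i))
  negative : ∀ i → i < n → firstLetterCount n u a m -[1+ i ] k ≡ continue⁻ i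
  negative i i<n = trans (letter-ih i -[1+ i ] i<n refl)
    (negativeLetter-continue (after i false) k (u (suc i)) (∣ a ∣ <ᵇ suc i) (allUsed u i) ⌊ -[1+ i ] ℤ.<? a ⌋ (negative-above-descent a i))

freeBelow-start : ∀ n → freeBelow n noneUsed (start n) ≡ n
freeBelow-start n = trans (sumBelow-cong n (λ j j<n → cong (λ z → 𝟙 (z ∧ true)) (<⇒<ᵇ≡true (s≤s j<n)))) (sumBelow-1 n)

freeAbove-start : ∀ n → freeAbove n noneUsed (start n) ≡ 0
freeAbove-start n =
  trans (sumBelow-cong n (λ j j<n → cong (λ z → 𝟙 (z ∧ true)) (≥⇒<ᵇ≡false {suc n} {suc j} (s≤s (<⇒≤ j<n))))) (sumBelow-zero n _ (λ _ → refl))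

unusedCount-noneUsed : ∀ n → unusedCount n noneUsed ≡ n
unusedCount-noneUsed zero    = refl
unusedCount-noneUsed (suc n) = cong suc (unusedCount-noneUsed n)

lastLetterUsed-start : ∀ n → LastLetterUsed n noneUsed (start n)
lastLetterUsed-start n v _ v≤n _ refl = contradiction v≤n 1+n≰n

d≡descentPoly : ∀ n k → d n k ≡ descentPoly n k
d≡descentPoly n k = begin
  d n k
    ≡⟨ d≡acceptedCount n k ⟩
  acceptedCount n noneUsed (start n) n k
    ≡⟨ acceptedCount≡completions n n noneUsed (start n) (lastLetterUsed-start n) (unusedCount-noneUsed n) k ⟩
  completions n (freeBelow n noneUsed (start n)) (freeAbove n noneUsed (start n)) false k
    ≡⟨ cong₂ (λ p q → completions n p q false k) (freeBelow-start n) (freeAbove-start n) ⟩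
  descentPoly n k ∎
  where open ≡-Reasoning

dSub≡shift^ : ∀ m k s → dSub m k s ≡ shift^ s (d m) k
dSub≡shift^ m k       zero          = refl
dSub≡shift^ m zero    (suc s)       = refl
dSub≡shift^ m (suc k) (suc zero)    = refl
dSub≡shift^ m (suc k) (suc (suc s)) = dSub≡shift^ m k (suc s)

mainTheorem15 : (n k : ℕ) → 1 ≤ n → k ≤ n ∸ 1 →
    d n k ≡ dSub (n ∸ 1) k 1 + d (n ∸ 1) k
      + 2 * sumFromTo 2 (n ∸ 1) (λ i →
          ((n ∸ 2) C (i ∸ 1)) * sumFromTo 0 (i ∸ 2) (λ j →
            ((i ∸ 2) C j) * dSub (n ∸ i) k (j + 1)))
mainTheorem15 (suc zero)    zero _ _ = refl
mainTheorem15 (suc (suc m)) k    _ _ = begin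
  d (suc (suc m)) k
    ≡⟨ d≡descentPoly (suc (suc m)) k ⟩
  descentPoly (suc (suc m)) k
    ≡⟨ descentPoly-recurrence m k ⟩
  (shift (descentPoly (suc m)) k + descentPoly (suc m) k) + 2 * sumBelow m (λ t → (m C suc t) * shift ([1+t]^ t (descentPoly (m ∸ t))) k)
    ≡⟨ cong₂ _+_ (cong₂ _+_ (shifted (suc m) 1) (sym (d≡descentPoly (suc m) k)))
                 (cong (2 *_) (trans (sumBelow-cong m (λ t _ → cong ((m C suc t) *_) (binomial-sum t))) (sym (sum-map-upTo m _)))) ⟩
  dSub (suc m) k 1 + d (suc m) k
    + 2 * sumFromTo 2 (suc m) (λ i → (m C (i ∸ 1)) * sumFromTo 0 (i ∸ 2) (λ j → ((i ∸ 2) C j) * dSub (suc (suc m) ∸ i) k (j + 1))) ∎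
  where
  open ≡-Reasoning
  shifted : ∀ r s → shift^ s (descentPoly r) k ≡ dSub r k s
  shifted r s = sym (trans (dSub≡shift^ r k s) (shift^-cong s (d≡descentPoly r) k))
  binomial-sum : ∀ t → shift ([1+t]^ t (descentPoly (m ∸ t))) k ≡ sumFromTo 0 t (λ j → (t C j) * dSub (m ∸ t) k (j + 1))
  binomial-sum t = begin
    shift ([1+t]^ t (descentPoly (m ∸ t))) k
      ≡⟨ shift-[1+t]^-expand t (descentPoly (m ∸ t)) k ⟩
    sumBelow (suc t) (λ j → (t C j) * shift^ (suc j) (descentPoly (m ∸ t)) k)
      ≡⟨ sumBelow-cong (suc t) (λ j _ → cong ((t C j) *_) (trans (cong (λ s → shift^ s (descentPoly (m ∸ t)) k) (+-comm 1 j)) (shifted (m ∸ t) (j + 1)))) ⟩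
    sumBelow (suc t) (λ j → (t C j) * dSub (m ∸ t) k (j + 1))
      ≡⟨ sym (sum-map-upTo (suc t) _) ⟩
    sumFromTo 0 t (λ j → (t C j) * dSub (m ∸ t) k (j + 1)) ∎
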